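{- For every $n\ge 1$, $|\mathcal{DRS}_n(213)|=S_n$, where $S_n$ is the number of Motzkin paths of length $n$ with no two consecutive up steps.
   Context: For $\sigma\in\mathfrak{S}_n$, a double descent is an index $i$ with $\sigma_i>\sigma_{i+1}>\sigma_{i+2}$. The permutation $\sigma$ is simsun if for every $k$, the subword of $\sigma$ consisting of the letters in $\{1,\dots,k\}$ (in the order they appear in $\sigma$) has no double descent. For $\omega\in\mathfrak{S}_t$, $\sigma$ contains an $\omega$-pattern if there are indices $i_1<\cdots<i_t$ with $\sigma_{i_j}<\sigma_{i_k}$ iff $\omega_j<\omega_k$; otherwise $\sigma$ is $\omega$-avoiding. $\mathcal{DRS}_n(\omega)$ is the set of $\sigma\in\mathfrak{S}_n$ such that $\sigma$ is $\omega$-avoiding and simsun and $\sigma^{ -1}$ is simsun ($\sigma^{ -1}$ need not avoid $\omega$). A Motzkin path of length $n$ is a lattice path from $(0,0)$ to $(n,0)$ with up steps $(1,1)$, down steps $(1,-1)$ and level steps $(1,0)$ never going below the $x$-axis. ($S_n$ is the secondary structure number: $1,1,2,4,8,17,\dots$ for $n=1,2,3,\dots$.) -}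

module Defs where

open import Data.Bool using (Bool; true; false; _∧_; _∨_; not; T)
open import Data.Nat using (ℕ; zero; suc; _<ᵇ_; _≡ᵇ_)
open import Data.Fin using (Fin; toℕ)
open import Data.List using (List; []; _∷_; map; filter; length; upTo; zip)
open import Data.Bool.ListAction using (all; any)
open import Data.Vec using (Vec; toList)
import Data.Vec as Vec
open import Data.Product using (Σ; _×_; _,_)
open import Data.Nat using (_<?_)

-- Convention: a permutation of [n] is a vector σ : Vec (Fin n) n (one-line
-- notation, values 0..n-1 standing for 1..n) whose entries are pairwise distinct.

distinct : List ℕ → Bool
distinct [] = true
distinct (x ∷ xs) = all (λ y → not (x ≡ᵇ y)) xs ∧ distinct xs

oneLine : ∀ {n} → Vec (Fin n) n → List ℕ
oneLine σ = toList (Vec.map toℕ σ)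

isPerm : ∀ {n} → Vec (Fin n) n → Bool
isPerm σ = distinct (oneLine σ)

position : ℕ → List ℕ → ℕ
position j [] = zero
position j (x ∷ xs) with j ≡ᵇ x
... | true = zero
... | false = suc (position j xs)

-- one-line notation of the inverse permutation: (σ⁻¹)(j) = position of j in σ
inverseLine : ℕ → List ℕ → List ℕ
inverseLine n w = map (λ j → position j w) (upTo n)

hasDoubleDescent : List ℕ → Bool
hasDoubleDescent (a ∷ b ∷ c ∷ rest) =
  ((b <ᵇ a) ∧ (c <ᵇ b)) ∨ hasDoubleDescent (b ∷ c ∷ rest)
hasDoubleDescent _ = false

-- restriction of w to the letters in {1,...,k} (0-based: letters < k)
restrict : ℕ → List ℕ → List ℕ
restrict k w = filter (λ x → x <? k) w

-- simsun: for every k (1 ≤ k ≤ n), the restriction to {1..k} has no double descent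
-- (k = 0 gives the empty word, harmless; k > n gives w itself, same as k = n)
simsun : ℕ → List ℕ → Bool
simsun n w = all (λ k → not (hasDoubleDescent (restrict (suc k) w))) (upTo n)

subsequences : List ℕ → List (List ℕ)
subsequences [] = [] ∷ []
subsequences (x ∷ xs) = map (x ∷_) (subsequences xs) Data.List.++ subsequences xs

-- s and ω are order isomorphic (same length assumed separately):
-- s_j < s_k iff ω_j < ω_k, for all positions j, k
sameOrder : List ℕ → List ℕ → Bool
sameOrder (a ∷ s) (b ∷ ω) =
  all (λ p → ((a <ᵇ Data.Product.proj₁ p) ≡B (b <ᵇ Data.Product.proj₂ p))
           ∧ ((Data.Product.proj₁ p <ᵇ a) ≡B (Data.Product.proj₂ p <ᵇ b)))
      (zip s ω)
  ∧ sameOrder s ω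
  where
    _≡B_ : Bool → Bool → Bool
    true ≡B true = true
    false ≡B false = true
    _ ≡B _ = false
sameOrder _ _ = true

containsPattern : List ℕ → List ℕ → Bool
containsPattern ω w =
  any (λ s → (length s ≡ᵇ length ω) ∧ sameOrder s ω) (subsequences w)

p213 : List ℕ
p213 = 2 ∷ 1 ∷ 3 ∷ []

isDRS : ∀ {n} → List ℕ → Vec (Fin n) n → Bool
isDRS {n} ω σ =
  isPerm σ ∧ not (containsPattern ω (oneLine σ))
  ∧ simsun n (oneLine σ) ∧ simsun n (inverseLine n (oneLine σ))

DRS : List ℕ → ℕ → Set
DRS ω n = Σ (Vec (Fin n) n) (λ σ → T (isDRS ω σ))

data Step : Set where
  U D L : Step

motzkinFrom : ℕ → List Step → Bool
motzkinFrom zero [] = true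
motzkinFrom (suc _) [] = false
motzkinFrom h (U ∷ p) = motzkinFrom (suc h) p
motzkinFrom zero (D ∷ p) = false
motzkinFrom (suc h) (D ∷ p) = motzkinFrom h p
motzkinFrom h (L ∷ p) = motzkinFrom h p

isMotzkin : List Step → Bool
isMotzkin = motzkinFrom zero

noUU : List Step → Bool
noUU (U ∷ U ∷ p) = false
noUU (_ ∷ p) = noUU p
noUU [] = true

MotzkinNoUU : ℕ → Set
MotzkinNoUU n = Σ (Vec Step n) (λ p → T (isMotzkin (toList p) ∧ noUU (toList p)))

-- Both sides are put in bijection with the trees 'MTree' of the first-return
-- decomposition  P → ε | L P | U D P | U L P' D P  of UU-free Motzkin paths.
-- A 213-avoiding permutation of [0..n) splits at its minimum as
-- node α β = (α above β) 0 (β shifted by one), with α and β 213-avoiding.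
-- Being simsun, together with the inverse, translates into conditions on α and
-- β which involve two more flags: whether the permutation, resp. its inverse,
-- stays simsun after appending a new minimum.  This gives four classes
-- (x , y) of permutations, closed under the decomposition; 'encode x y' maps
-- the trees bijectively onto the permutations of class (x , y) of length at
-- least x + y, and DRS_n(213) is the class (false , false).
module Submission where

module Permutations where

  open import Data.Nat using (ℕ; zero; suc; _+_; _∸_; _≤_; _<_; z≤n; s≤s)
  open import Data.Nat.Properties
  open import Data.List.Membership.DecPropositional _≟_ using (_∈?_)
  open import Data.List using (List; []; _∷_; _++_; map; length; applyUpTo)
  open import Data.List.Properties using (length-applyUpTo; length-map; length-++; map-∘; map-id-local; map-injective; ∷-injective; ∷-injectiveˡ; ∷-injectiveʳ)
  open import Data.List.Membership.Propositional using (_∈_; _∉_)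
  open import Data.List.Membership.Propositional.Properties using (∈-map⁺; ∈-map⁻; ∈-++⁺ˡ; ∈-++⁺ʳ; ∈-++⁻; ∈-applyUpTo⁺; ∈-applyUpTo⁻)
  open import Data.List.Relation.Unary.Any using (here; there)
  open import Data.Product using (Σ; _×_; _,_; proj₁; proj₂)
  open import Data.Sum using (inj₁; inj₂)
  open import Data.Empty using (⊥-elim)
  open import Data.Unit using (⊤; tt)
  open import Relation.Nullary using (yes; no)
  open import Relation.Binary.PropositionalEquality using (_≡_; _≢_; refl; sym; trans; cong; cong₂; subst; subst₂)
  open import Data.List.Relation.Unary.All using (tabulate)
  open import Function using (_∘_)

  Dist : List ℕ → Set
  Dist [] = ⊤
  Dist (x ∷ xs) = (x ∉ xs) × Dist xs

  dist-map : ∀ (f : ℕ → ℕ) xs → Dist xs → (∀ {x y} → x ∈ xs → y ∈ xs → f x ≡ f y → x ≡ y) → Dist (map f xs)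
  dist-map f [] d inj = tt
  dist-map f (x ∷ xs) (x∉ , d) inj = fresh , dist-map f xs d (λ p q → inj (there p) (there q))
    where
    fresh : f x ∉ map f xs
    fresh p with ∈-map⁻ _ p
    ... | y , y∈ , e with inj (here refl) (there y∈) e
    ... | refl = x∉ y∈

  dist-++ : ∀ xs ys → Dist xs → Dist ys → (∀ {x} → x ∈ xs → x ∉ ys) → Dist (xs ++ ys)
  dist-++ [] ys dx dy disj = dy
  dist-++ (x ∷ xs) ys (x∉ , dx) dy disj = fresh , dist-++ xs ys dx dy (disj ∘ there)
    where
    fresh : x ∉ xs ++ ys
    fresh p with ∈-++⁻ xs p
    ... | inj₁ q = x∉ q
    ... | inj₂ q = disj (here refl) q

  dist-++⁻ : ∀ xs ys → Dist (xs ++ ys) → Dist xs × Dist ys × (∀ {x} → x ∈ xs → x ∉ ys)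
  dist-++⁻ [] ys d = tt , d , λ ()
  dist-++⁻ (x ∷ xs) ys (x∉ , d) with dist-++⁻ xs ys d
  ... | dx , dy , disj = ((x∉ ∘ ∈-++⁺ˡ) , dx) , dy , disj'
    where
    disj' : ∀ {z} → z ∈ x ∷ xs → z ∉ ys
    disj' (here refl) q = x∉ (∈-++⁺ʳ xs q)
    disj' (there p) q = disj p q

  -- Pigeonhole: a duplicate-free list contained in another one is not longer.
  -- Proof by removing the first element from the larger list.
  remove : ℕ → List ℕ → List ℕ
  remove y [] = []
  remove y (x ∷ xs) with y ≟ x
  ... | yes _ = xs
  ... | no _ = x ∷ remove y xs

  length-remove : ∀ {y} xs → y ∈ xs → suc (length (remove y xs)) ≡ length xs
  length-remove {y} (x ∷ xs) p with y ≟ x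
  ... | yes _ = refl
  length-remove {y} (x ∷ xs) (here e) | no y≢x = ⊥-elim (y≢x e)
  length-remove {y} (x ∷ xs) (there p) | no _ = cong suc (length-remove xs p)

  ∈-remove : ∀ {y z} xs → z ∈ xs → z ≢ y → z ∈ remove y xs
  ∈-remove {y} (x ∷ xs) p z≢y with y ≟ x
  ∈-remove {y} (x ∷ xs) (here e) z≢y | yes y≡x = ⊥-elim (z≢y (trans e (sym y≡x)))
  ∈-remove {y} (x ∷ xs) (there p) z≢y | yes _ = p
  ∈-remove {y} (x ∷ xs) (here e) z≢y | no _ = here e
  ∈-remove {y} (x ∷ xs) (there p) z≢y | no _ = there (∈-remove xs p z≢y)

  pigeonhole : ∀ ys xs → Dist ys → (∀ {z} → z ∈ ys → z ∈ xs) → length ys ≤ length xs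
  pigeonhole [] xs d sub = z≤n
  pigeonhole (y ∷ ys) xs (y∉ , d) sub =
    subst (suc (length ys) ≤_) (length-remove xs (sub (here refl)))
      (s≤s (pigeonhole ys (remove y xs) d (λ {z} p → ∈-remove xs (sub (there p)) (λ { refl → y∉ p }))))

  range : ℕ → ℕ → List ℕ
  range c k = applyUpTo (c +_) k

  ∈-range⁺ : ∀ {c k x} → c ≤ x → x < c + k → x ∈ range c k
  ∈-range⁺ {c} {k} {x} c≤x x<c+k =
    subst (_∈ range c k) (m+[n∸m]≡n c≤x) (∈-applyUpTo⁺ (c +_) (+-cancelˡ-< c _ _ (subst (_< c + k) (sym (m+[n∸m]≡n c≤x)) x<c+k)))

  ∈-range⁻ : ∀ {c k x} → x ∈ range c k → c ≤ x × x < c + k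
  ∈-range⁻ {c} p with ∈-applyUpTo⁻ (c +_) p
  ... | i , i<k , refl = m≤m+n c i , +-monoʳ-< c i<k

  dist-applyUpTo : ∀ (f : ℕ → ℕ) n → (∀ {i j} → f i ≡ f j → i ≡ j) → Dist (applyUpTo f n)
  dist-applyUpTo f zero inj = tt
  dist-applyUpTo f (suc n) inj = fresh , dist-applyUpTo (f ∘ suc) n (suc-injective ∘ inj)
    where
    fresh : f 0 ∉ applyUpTo (f ∘ suc) n
    fresh p with ∈-applyUpTo⁻ (f ∘ suc) p
    ... | i , _ , e with inj e
    ... | ()

  dist-range : ∀ c k → Dist (range c k)
  dist-range c k = dist-applyUpTo (c +_) k (+-cancelˡ-≡ c _ _)

  record Interval (c m : ℕ) (w : List ℕ) : Set where
    constructor mkInterval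
    field
      idist : Dist w
      ibound : ∀ {x} → x ∈ w → c ≤ x × x < c + m
      icover : ∀ {x} → c ≤ x → x < c + m → x ∈ w
  open Interval public

  -- an interval word has exactly m letters (pigeonhole in both directions)
  interval-length : ∀ {c m w} → Interval c m w → length w ≡ m
  interval-length {c} {m} {w} I = ≤-antisym
    (subst (length w ≤_) (length-applyUpTo (c +_) m)
      (pigeonhole w (range c m) (idist I) (λ p → ∈-range⁺ (proj₁ (ibound I p)) (proj₂ (ibound I p)))))
    (subst (_≤ length w) (length-applyUpTo (c +_) m)
      (pigeonhole (range c m) w (dist-range c m) (λ p → icover I (proj₁ (∈-range⁻ p)) (proj₂ (∈-range⁻ p)))))

  interval-swap : ∀ {c m} X Y → Interval c m (X ++ Y) → Interval c m (Y ++ X)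
  interval-swap {c} {m} X Y I = mkInterval dist bound cover
    where
    parts = dist-++⁻ X Y (idist I)
    dist : Dist (Y ++ X)
    dist = dist-++ Y X (proj₁ (proj₂ parts)) (proj₁ parts) (λ y∈Y x∈X → proj₂ (proj₂ parts) x∈X y∈Y)
    bound : ∀ {x} → x ∈ Y ++ X → c ≤ x × x < c + m
    bound p with ∈-++⁻ Y p
    ... | inj₁ q = ibound I (∈-++⁺ʳ X q)
    ... | inj₂ q = ibound I (∈-++⁺ˡ q)
    cover : ∀ {x} → c ≤ x → x < c + m → x ∈ Y ++ X
    cover l u with ∈-++⁻ X (icover I l u)
    ... | inj₁ q = ∈-++⁺ʳ Y q
    ... | inj₂ q = ∈-++⁺ˡ q

  shift : ∀ {c m w} d → Interval c m w → Interval (d + c) m (map (d +_) w)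
  shift {c} {m} {w} d I = mkInterval (dist-map (d +_) w (idist I) (λ _ _ → +-cancelˡ-≡ d _ _)) bound cover
    where
    bound : ∀ {x} → x ∈ map (d +_) w → d + c ≤ x × x < d + c + m
    bound p with ∈-map⁻ (d +_) p
    ... | y , y∈ , refl = +-monoʳ-≤ d (proj₁ (ibound I y∈)) , subst (d + y <_) (sym (+-assoc d c m)) (+-monoʳ-< d (proj₂ (ibound I y∈)))
    cover : ∀ {x} → d + c ≤ x → x < d + c + m → x ∈ map (d +_) w
    cover {x} l u = subst (_∈ map (d +_) w) x≡ (∈-map⁺ (d +_) (icover I c≤ <c+m))
      where
      x≡ : d + (x ∸ d) ≡ x
      x≡ = m+[n∸m]≡n (≤-trans (m≤m+n d c) l)
      c≤ : c ≤ x ∸ d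
      c≤ = +-cancelˡ-≤ d c (x ∸ d) (subst (d + c ≤_) (sym x≡) l)
      <c+m : x ∸ d < c + m
      <c+m = +-cancelˡ-< d (x ∸ d) (c + m) (subst₂ _<_ (sym x≡) (+-assoc d c m) u)

  unshift : ∀ {c m w} d → Interval (d + c) m w → Σ (List ℕ) λ w' → Interval c m w' × w ≡ map (d +_) w'
  unshift {c} {m} {w} d I = map (_∸ d) w , mkInterval dist bound cover , sym back
    where
    d≤ : ∀ {x} → x ∈ w → d ≤ x
    d≤ p = ≤-trans (m≤m+n d c) (proj₁ (ibound I p))
    back : map (d +_) (map (_∸ d) w) ≡ w
    back = trans (sym (map-∘ w)) (map-id-local (tabulate (m+[n∸m]≡n ∘ d≤)))
    dist : Dist (map (_∸ d) w)
    dist = dist-map (_∸ d) w (idist I) (λ p q e → trans (sym (m+[n∸m]≡n (d≤ p))) (trans (cong (d +_) e) (m+[n∸m]≡n (d≤ q))))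
    bound : ∀ {x} → x ∈ map (_∸ d) w → c ≤ x × x < c + m
    bound p with ∈-map⁻ (_∸ d) p
    ... | y , y∈ , refl with ibound I y∈
    ... | l , u = +-cancelˡ-≤ d c (y ∸ d) (subst (d + c ≤_) (sym (m+[n∸m]≡n (d≤ y∈))) l)
                , +-cancelˡ-< d (y ∸ d) (c + m) (subst₂ _<_ (sym (m+[n∸m]≡n (d≤ y∈))) (+-assoc d c m) u)
    cover : ∀ {x} → c ≤ x → x < c + m → x ∈ map (_∸ d) w
    cover {x} l u = subst (_∈ map (_∸ d) w) (m+n∸m≡n d x)
      (∈-map⁺ (_∸ d) (icover I (+-monoʳ-≤ d l) (subst (d + x <_) (sym (+-assoc d c m)) (+-monoʳ-< d u))))

  range-≤ : ∀ {c y z} → c ≤ y → z ∈ range c (suc (y ∸ c)) → c ≤ z × z ≤ y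
  range-≤ {c} {y} {z} c≤y z∈ with ∈-range⁻ z∈
  ... | c≤z , z< = c≤z , ≤-pred (subst (z <_) (trans (+-suc c _) (cong suc (m+[n∸m]≡n c≤y))) z<)

  Above : List ℕ → List ℕ → Set
  Above X Y = ∀ {x y} → x ∈ X → y ∈ Y → y < x

  join : ∀ {c m m' X Y} → Interval (c + m) m' X → Interval c m Y → Interval c (m + m') (X ++ Y)
  join {c} {m} {m'} {X} {Y} IX IY = mkInterval dist bound cover
    where
    above : Above X Y
    above x∈ y∈ = <-≤-trans (proj₂ (ibound IY y∈)) (proj₁ (ibound IX x∈))
    dist : Dist (X ++ Y)
    dist = dist-++ X Y (idist IX) (idist IY) (λ x∈ x∈′ → <-irrefl refl (above x∈ x∈′))
    bound : ∀ {x} → x ∈ X ++ Y → c ≤ x × x < c + (m + m')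
    bound {x} p with ∈-++⁻ X p
    ... | inj₁ q = ≤-trans (m≤m+n c m) (proj₁ (ibound IX q)) , subst (x <_) (+-assoc c m m') (proj₂ (ibound IX q))
    ... | inj₂ q = proj₁ (ibound IY q) , <-≤-trans (proj₂ (ibound IY q)) (+-monoʳ-≤ c (m≤m+n m m'))
    cover : ∀ {x} → c ≤ x → x < c + (m + m') → x ∈ X ++ Y
    cover {x} l u with x <? c + m
    ... | yes low = ∈-++⁺ʳ X (icover IY l low)
    ... | no high = ∈-++⁺ˡ (icover IX (≮⇒≥ high) (subst (x <_) (sym (+-assoc c m m')) u))

  -- The bound on each block is a pigeonhole count: the letters
  -- c, …, y of the interval below a letter y of Y all lie in Y, and Y lies
  -- below every letter x of X.
  split : ∀ {c m} X Y → Interval c m (X ++ Y) → Above X Y → Interval (c + length Y) (length X) X × Interval c (length Y) Y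
  split {c} {m} X Y I above = mkInterval dX boundX coverX , mkInterval dY boundY coverY
    where
    parts = dist-++⁻ X Y (idist I)
    dX = proj₁ parts
    dY = proj₁ (proj₂ parts)
    m≡ : length X + length Y ≡ m
    m≡ = trans (sym (length-++ X)) (interval-length I)
    Y-small : ∀ {y} → y ∈ Y → y < c + length Y
    Y-small {y} y∈ = subst (_< c + length Y) (m+[n∸m]≡n c≤y) (+-monoʳ-< c count)
      where
      c≤y = proj₁ (ibound I (∈-++⁺ʳ X y∈))
      below-y : ∀ {z} → z ∈ range c (suc (y ∸ c)) → z ∈ Y
      below-y {z} z∈ with range-≤ c≤y z∈
      ... | c≤z , z≤y with ∈-++⁻ X (icover I c≤z (≤-<-trans z≤y (proj₂ (ibound I (∈-++⁺ʳ X y∈)))))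
      ... | inj₁ z∈X = ⊥-elim (<-irrefl refl (<-≤-trans (above z∈X y∈) z≤y))
      ... | inj₂ z∈Y = z∈Y
      count : suc (y ∸ c) ≤ length Y
      count = subst (_≤ length Y) (length-applyUpTo (c +_) _) (pigeonhole _ Y (dist-range c _) below-y)
    X-large : ∀ {x} → x ∈ X → c + length Y ≤ x
    X-large {x} x∈ = subst (c + length Y ≤_) (m+[n∸m]≡n c≤x) (+-monoʳ-≤ c count)
      where
      c≤x = proj₁ (ibound I (∈-++⁺ˡ x∈))
      below-x : ∀ {z} → z ∈ Y → z ∈ range c (x ∸ c)
      below-x z∈ = ∈-range⁺ (proj₁ (ibound I (∈-++⁺ʳ X z∈))) (subst (_ <_) (sym (m+[n∸m]≡n c≤x)) (above x∈ z∈))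
      count : length Y ≤ x ∸ c
      count = subst (length Y ≤_) (length-applyUpTo (c +_) _) (pigeonhole Y _ dY below-x)
    boundX : ∀ {x} → x ∈ X → c + length Y ≤ x × x < c + length Y + length X
    boundX {x} x∈ = X-large x∈ ,
      subst (x <_) (trans (cong (c +_) (trans (sym m≡) (+-comm (length X) (length Y)))) (sym (+-assoc c _ _)))
        (proj₂ (ibound I (∈-++⁺ˡ x∈)))
    coverX : ∀ {x} → c + length Y ≤ x → x < c + length Y + length X → x ∈ X
    coverX {x} l u with ∈-++⁻ X (icover I (≤-trans (m≤m+n c _) l) (subst (x <_) (trans (+-assoc c _ _) (cong (c +_) (trans (+-comm (length Y) (length X)) m≡))) u))
    ... | inj₁ x∈X = x∈X
    ... | inj₂ x∈Y = ⊥-elim (<-irrefl refl (<-≤-trans (Y-small x∈Y) l))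
    boundY : ∀ {y} → y ∈ Y → c ≤ y × y < c + length Y
    boundY y∈ = proj₁ (ibound I (∈-++⁺ʳ X y∈)) , Y-small y∈
    coverY : ∀ {y} → c ≤ y → y < c + length Y → y ∈ Y
    coverY {y} l u with ∈-++⁻ X (icover I l (<-≤-trans u (+-monoʳ-≤ c (subst (length Y ≤_) m≡ (m≤n+m (length Y) (length X))))))
    ... | inj₁ y∈X = ⊥-elim (<-irrefl refl (<-≤-trans u (X-large y∈X)))
    ... | inj₂ y∈Y = y∈Y

  Perm : ℕ → List ℕ → Set
  Perm = Interval 0

  mkPerm : ∀ {n w} → Dist w → (∀ {x} → x ∈ w → x < n) → (∀ {x} → x < n → x ∈ w) → Perm n w
  mkPerm d below cover = mkInterval d (λ p → z≤n , below p) (λ _ → cover)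

  pdist : ∀ {n w} → Perm n w → Dist w
  pdist = idist

  pbound : ∀ {n w} → Perm n w → ∀ {x} → x ∈ w → x < n
  pbound p q = proj₂ (ibound p q)

  pcover : ∀ {n w} → Perm n w → ∀ {x} → x < n → x ∈ w
  pcover p = icover p z≤n

  perm-length : ∀ {n w} → Perm n w → length w ≡ n
  perm-length = interval-length

  perm-one : ∀ {w} → Perm 1 w → w ≡ 0 ∷ []
  perm-one {w} p with perm-length p
  perm-one {x ∷ []} p | refl with pbound p (here refl)
  ... | s≤s z≤n = refl

  distinct-below⇒Perm : ∀ {n} w → length w ≡ n → (∀ {x} → x ∈ w → x < n) → Dist w → Perm n w
  distinct-below⇒Perm {n} w len below d = mkPerm d below covers
    where
    covers : ∀ {x} → x < n → x ∈ w
    covers {x} x<n with x ∈? w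
    ... | yes x∈w = x∈w
    ... | no x∉w = ⊥-elim (<-irrefl refl (subst (_≤ n) (cong suc len) (subst (suc (length w) ≤_) (length-applyUpTo (0 +_) n)
            (pigeonhole (x ∷ w) (range 0 n) (x∉w , d) sub))))
      where
      sub : ∀ {y} → y ∈ x ∷ w → y ∈ range 0 n
      sub (here refl) = ∈-range⁺ z≤n x<n
      sub (there y∈w) = ∈-range⁺ z≤n (below y∈w)

  -- 'node α β' is the permutation  (α shifted above β) 0 (β shifted by 1):
  -- every 213-avoiding permutation has this form, with α and β 213-avoiding.
  node : List ℕ → List ℕ → List ℕ
  node α β = map (suc (length β) +_) α ++ 0 ∷ map suc β

  length-node : ∀ α β → length (node α β) ≡ length α + suc (length β)
  length-node α β = trans (length-++ (map (suc (length β) +_) α)) (cong₂ (λ s t → s + suc t) (length-map _ α) (length-map suc β))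

  perm-node : ∀ {a b α β} → Perm a α → Perm b β → Perm (a + suc b) (node α β)
  perm-node {a} {b} {α} {β} pα pβ = subst (λ k → Perm k (node α β)) (+-comm (suc b) a) (join high low)
    where
    single : Interval 0 1 (0 ∷ [])
    single = mkInterval ((λ ()) , tt) (λ { (here refl) → z≤n , s≤s z≤n }) (λ { z≤n (s≤s z≤n) → here refl })
    low : Interval 0 (suc b) (0 ∷ map suc β)
    low = interval-swap (map suc β) (0 ∷ []) (join (shift 1 pβ) single)
    high : Interval (suc b) a (map (suc (length β) +_) α)
    high = subst (λ c → Interval c a (map (suc (length β) +_) α)) (trans (+-identityʳ _) (cong suc (perm-length pβ))) (shift (suc (length β)) pα)

  record Split (n : ℕ) (w : List ℕ) : Set where
    constructor mkSplit
    field
      sα sβ : List ℕ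
      s-eq : w ≡ node sα sβ
      s-pα : Perm (length sα) sα
      s-pβ : Perm (length sβ) sβ
      s-n : length sα + suc (length sβ) ≡ n
  open Split public

  -- u and v are intervals by 'split'; shifting them down gives α and β
  perm-split : ∀ {n} u v → Perm n (u ++ 0 ∷ v) → Above u v → Split n (u ++ 0 ∷ v)
  perm-split {n} u v pw above = mkSplit α β w≡ pα pβ size
    where
    parts = dist-++⁻ u (0 ∷ v) (pdist pw)
    nonzero-u : ∀ {x} → x ∈ u → 0 < x
    nonzero-u {zero} x∈u = ⊥-elim (proj₂ (proj₂ parts) x∈u (here refl))
    nonzero-u {suc x} _ = s≤s z≤n
    nonzero-v : ∀ {y} → y ∈ v → 0 < y
    nonzero-v {zero} y∈v = ⊥-elim (proj₁ (proj₁ (proj₂ parts)) y∈v)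
    nonzero-v {suc y} _ = s≤s z≤n
    blocks = split u (0 ∷ v) pw (λ { x∈u (here refl) → nonzero-u x∈u ; x∈u (there y∈v) → above x∈u y∈v })
    Iv : Interval 1 (length v) v
    Iv = proj₁ (split v (0 ∷ []) (interval-swap (0 ∷ []) v (proj₂ blocks)) (λ { y∈v (here refl) → nonzero-v y∈v }))
    Iu : Interval (suc (length v) + 0) (length u) u
    Iu = subst (λ c → Interval c (length u) u) (sym (+-identityʳ _)) (proj₁ blocks)
    β = proj₁ (unshift 1 Iv)
    α = proj₁ (unshift (suc (length v)) Iu)
    pβ : Perm (length β) β
    pβ = subst (λ k → Perm k β) (sym (interval-length (proj₁ (proj₂ (unshift 1 Iv))))) (proj₁ (proj₂ (unshift 1 Iv)))
    pα : Perm (length α) α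
    pα = subst (λ k → Perm k α) (sym (interval-length (proj₁ (proj₂ (unshift (suc (length v)) Iu))))) (proj₁ (proj₂ (unshift (suc (length v)) Iu)))
    lβ : length β ≡ length v
    lβ = interval-length (proj₁ (proj₂ (unshift 1 Iv)))
    w≡ : u ++ 0 ∷ v ≡ node α β
    w≡ = cong₂ (λ s t → s ++ 0 ∷ t)
           (trans (proj₂ (proj₂ (unshift (suc (length v)) Iu))) (cong (λ k → map (suc k +_) α) (sym lβ)))
           (proj₂ (proj₂ (unshift 1 Iv)))
    size : length α + suc (length β) ≡ n
    size = trans (sym (length-node α β)) (trans (cong length (sym w≡)) (perm-length pw))

  split-at-0 : ∀ X Y X' Y' → 0 ∉ X → 0 ∉ X' → X ++ 0 ∷ Y ≡ X' ++ 0 ∷ Y' → X ≡ X' × Y ≡ Y'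
  split-at-0 [] Y [] Y' _ _ e = refl , ∷-injectiveʳ e
  split-at-0 [] Y (x' ∷ X') Y' _ 0∉X' e = ⊥-elim (0∉X' (here (∷-injectiveˡ e)))
  split-at-0 (x ∷ X) Y [] Y' 0∉X _ e = ⊥-elim (0∉X (here (sym (∷-injectiveˡ e))))
  split-at-0 (x ∷ X) Y (x' ∷ X') Y' 0∉X 0∉X' e with ∷-injective e
  ... | refl , e' with split-at-0 X Y X' Y' (0∉X ∘ there) (0∉X' ∘ there) e'
  ... | refl , eY = refl , eY

  node-injective : ∀ α β α' β' → node α β ≡ node α' β' → α ≡ α' × β ≡ β'
  node-injective α β α' β' e with split-at-0 _ _ _ _ (0∉shift β α) (0∉shift β' α') e
    where
    0∉shift : ∀ β α → 0 ∉ map (suc (length β) +_) α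
    0∉shift β α p with ∈-map⁻ _ p
    ... | _ , _ , ()
  ... | eA , eB with map-injective suc-injective eB
  ... | refl = map-injective (+-cancelˡ-≡ (suc (length β)) _ _) eA , refl

-- Restrictions to small letters, double descents, and the simsun property.
module SimsunWords where

  open import Defs using (hasDoubleDescent; restrict)
  open Permutations
  open import Data.Bool using (Bool; true; false; _∧_; _∨_; T)
  open import Data.Bool.Properties using (∨-assoc; ∨-zeroʳ; ∨-conicalˡ; ∨-conicalʳ)
  open import Data.Nat using (ℕ; zero; suc; _+_; _≤_; _<_; z≤n; s≤s; _<ᵇ_)
  open import Data.Nat.Properties
  open import Data.List using (List; []; _∷_; _++_; map; length; take)
  open import Data.List.Properties using (map-++; map-∘)
  open import Data.List.Membership.Propositional using (_∈_)
  open import Data.List.Relation.Unary.Any using (here; there)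
  open import Data.Product using (Σ; _×_; _,_; proj₁; proj₂)
  open import Data.Sum using (_⊎_; inj₁; inj₂)
  open import Data.Empty using (⊥; ⊥-elim)
  open import Data.Unit using (tt)
  open import Relation.Nullary using (yes; no)
  open import Relation.Binary.Definitions using (tri<; tri≈; tri>)
  open import Relation.Binary.PropositionalEquality using (_≡_; refl; sym; trans; cong; cong₂; subst; _≢_; module ≡-Reasoning)
  open import Function using (_∘_)

  hDD : List ℕ → Bool
  hDD = hasDoubleDescent

  compare-<ᵇ : ∀ x y → (x < y × (x <ᵇ y) ≡ true) ⊎ (y ≤ x × (x <ᵇ y) ≡ false)
  compare-<ᵇ x y with x <ᵇ y in eq
  ... | true = inj₁ (<ᵇ⇒< x y (subst T (sym eq) tt) , refl)
  ... | false = inj₂ (≮⇒≥ (λ lt → subst T eq (<⇒<ᵇ lt)) , refl)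

  <ᵇ-true : ∀ {x y} → x < y → (x <ᵇ y) ≡ true
  <ᵇ-true {x} {y} lt with compare-<ᵇ x y
  ... | inj₁ (_ , e) = e
  ... | inj₂ (ge , _) = ⊥-elim (<-irrefl refl (<-≤-trans lt ge))

  <ᵇ-false : ∀ {x y} → y ≤ x → (x <ᵇ y) ≡ false
  <ᵇ-false {x} {y} ge with compare-<ᵇ x y
  ... | inj₁ (lt , _) = ⊥-elim (<-irrefl refl (<-≤-trans lt ge))
  ... | inj₂ (_ , e) = e

  Increasing : (ℕ → ℕ) → Set
  Increasing f = ∀ {x y} → x < y → f x < f y

  +-increasing : ∀ c → Increasing (c +_)
  +-increasing c = +-monoʳ-< c

  module _ {f : ℕ → ℕ} (inc : Increasing f) where
    increasing-injective : ∀ {x y} → f x ≡ f y → x ≡ y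
    increasing-injective {x} {y} e with <-cmp x y
    ... | tri< x<y _ _ = ⊥-elim (<-irrefl e (inc x<y))
    ... | tri≈ _ x≡y _ = x≡y
    ... | tri> _ _ y<x = ⊥-elim (<-irrefl (sym e) (inc y<x))

    increasing-≤ : ∀ {x y} → x ≤ y → f x ≤ f y
    increasing-≤ le with m≤n⇒m<n∨m≡n le
    ... | inj₁ lt = <⇒≤ (inc lt)
    ... | inj₂ refl = ≤-refl

    increasing-reflects-≤ : ∀ {x y} → f x ≤ f y → x ≤ y
    increasing-reflects-≤ {x} {y} le with <-cmp x y
    ... | tri< x<y _ _ = <⇒≤ x<y
    ... | tri≈ _ refl _ = ≤-refl
    ... | tri> _ _ y<x = ⊥-elim (<-irrefl refl (<-≤-trans (inc y<x) le))

    increasing-reflects-< : ∀ {x y} → f x < f y → x < y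
    increasing-reflects-< {x} {y} lt with <-cmp x y
    ... | tri< x<y _ _ = x<y
    ... | tri≈ _ refl _ = ⊥-elim (<-irrefl refl lt)
    ... | tri> _ _ y<x = ⊥-elim (<-asym lt (inc y<x))

    increasing-<ᵇ : ∀ x y → (f x <ᵇ f y) ≡ (x <ᵇ y)
    increasing-<ᵇ x y with compare-<ᵇ x y
    ... | inj₁ (lt , e) = trans (<ᵇ-true (inc lt)) (sym e)
    ... | inj₂ (ge , e) = trans (<ᵇ-false (increasing-≤ ge)) (sym e)

  restrict-keep : ∀ {k x} xs → x < k → restrict k (x ∷ xs) ≡ x ∷ restrict k xs
  restrict-keep {k} {x} xs lt rewrite <ᵇ-true lt = refl

  restrict-drop : ∀ {k x} xs → k ≤ x → restrict k (x ∷ xs) ≡ restrict k xs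
  restrict-drop {k} {x} xs ge rewrite <ᵇ-false {x} {k} ge = refl

  restrict-cons : ∀ {k} x xs → (x < k × restrict k (x ∷ xs) ≡ x ∷ restrict k xs) ⊎ (k ≤ x × restrict k (x ∷ xs) ≡ restrict k xs)
  restrict-cons {k} x xs with compare-<ᵇ x k
  ... | inj₁ (lt , _) = inj₁ (lt , restrict-keep xs lt)
  ... | inj₂ (ge , _) = inj₂ (ge , restrict-drop xs ge)

  restrict-++ : ∀ k xs ys → restrict k (xs ++ ys) ≡ restrict k xs ++ restrict k ys
  restrict-++ k [] ys = refl
  restrict-++ k (x ∷ xs) ys with restrict-cons {k} x (xs ++ ys) | restrict-cons {k} x xs
  ... | inj₁ (_ , e1) | inj₁ (_ , e2) = trans e1 (trans (cong (x ∷_) (restrict-++ k xs ys)) (cong (_++ restrict k ys) (sym e2)))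
  ... | inj₂ (_ , e1) | inj₂ (_ , e2) = trans e1 (trans (restrict-++ k xs ys) (cong (_++ restrict k ys) (sym e2)))
  ... | inj₁ (lt , _) | inj₂ (ge , _) = ⊥-elim (<-irrefl refl (<-≤-trans lt ge))
  ... | inj₂ (ge , _) | inj₁ (lt , _) = ⊥-elim (<-irrefl refl (<-≤-trans lt ge))

  restrict-all : ∀ k xs → (∀ {x} → x ∈ xs → x < k) → restrict k xs ≡ xs
  restrict-all k [] h = refl
  restrict-all k (x ∷ xs) h = trans (restrict-keep xs (h (here refl))) (cong (x ∷_) (restrict-all k xs (λ p → h (there p))))

  restrict-none : ∀ k xs → (∀ {x} → x ∈ xs → k ≤ x) → restrict k xs ≡ []
  restrict-none k [] h = refl
  restrict-none k (x ∷ xs) h = trans (restrict-drop xs (h (here refl))) (restrict-none k xs (λ p → h (there p)))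

  restrict-∈ : ∀ {k z} xs → z ∈ restrict k xs → z ∈ xs × z < k
  restrict-∈ {k} [] ()
  restrict-∈ {k} (x ∷ xs) p with restrict-cons {k} x xs
  ... | inj₁ (lt , e) with subst (_ ∈_) e p
  ... | here refl = here refl , lt
  ... | there q = let (a , b) = restrict-∈ xs q in there a , b
  restrict-∈ {k} (x ∷ xs) p | inj₂ (ge , e) = let (a , b) = restrict-∈ xs (subst (_ ∈_) e p) in there a , b

  restrict-length : ∀ k xs → length (restrict k xs) ≤ length xs
  restrict-length k [] = z≤n
  restrict-length k (x ∷ xs) with restrict-cons {k} x xs
  ... | inj₁ (_ , e) rewrite e = s≤s (restrict-length k xs)
  ... | inj₂ (_ , e) rewrite e = m≤n⇒m≤1+n (restrict-length k xs)

  all-≥-or-some-< : ∀ k xs → (∀ {x} → x ∈ xs → k ≤ x) ⊎ (Σ ℕ λ x → x ∈ xs × x < k)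
  all-≥-or-some-< k [] = inj₁ (λ ())
  all-≥-or-some-< k (x ∷ xs) with compare-<ᵇ x k
  ... | inj₁ (lt , _) = inj₂ (x , here refl , lt)
  ... | inj₂ (ge , _) with all-≥-or-some-< k xs
  ... | inj₁ h = inj₁ λ { (here refl) → ge ; (there p) → h p }
  ... | inj₂ (y , p , l) = inj₂ (y , there p , l)

  -- Double descents.  'start a L' tests for a double descent starting at a
  -- letter a followed by L; a double descent of Z ++ Y either lies in Y or
  -- starts in Z and then only involves the first two letters of Y.
  start : ℕ → List ℕ → Bool
  start a (b ∷ c ∷ _) = (b <ᵇ a) ∧ (c <ᵇ b)
  start a _ = false

  hDD-cons : ∀ a L → hDD (a ∷ L) ≡ start a L ∨ hDD L
  hDD-cons a [] = refl
  hDD-cons a (b ∷ []) = refl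
  hDD-cons a (b ∷ c ∷ L) = refl

  hDD-short : ∀ L → length L ≤ 2 → hDD L ≡ false
  hDD-short [] _ = refl
  hDD-short (a ∷ []) _ = refl
  hDD-short (a ∷ b ∷ []) _ = refl
  hDD-short (a ∷ b ∷ c ∷ L) (s≤s (s≤s ()))

  take2-short : ∀ (Y : List ℕ) → length (take 2 Y) ≤ 2
  take2-short [] = z≤n
  take2-short (a ∷ []) = s≤s z≤n
  take2-short (a ∷ b ∷ Y) = s≤s (s≤s z≤n)

  take2-⊆ : ∀ (Y : List ℕ) {z} → z ∈ take 2 Y → z ∈ Y
  take2-⊆ (a ∷ Y) (here e) = here e
  take2-⊆ (a ∷ b ∷ Y) (there (here e)) = there (here e)

  start-take : ∀ a Z Y → start a (Z ++ Y) ≡ start a (Z ++ take 2 Y)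
  start-take a [] [] = refl
  start-take a [] (y ∷ []) = refl
  start-take a [] (y ∷ y' ∷ Y) = refl
  start-take a (b ∷ []) [] = refl
  start-take a (b ∷ []) (y ∷ Y) = refl
  start-take a (b ∷ c ∷ Z) Y = refl

  hDD-++ : ∀ Z Y → hDD (Z ++ Y) ≡ hDD (Z ++ take 2 Y) ∨ hDD Y
  hDD-++ [] Y = sym (cong (_∨ hDD Y) (hDD-short (take 2 Y) (take2-short Y)))
  hDD-++ (a ∷ Z) Y =
    trans (hDD-cons a (Z ++ Y))
    (trans (cong₂ _∨_ (start-take a Z Y) (hDD-++ Z Y))
    (trans (sym (∨-assoc (start a (Z ++ take 2 Y)) (hDD (Z ++ take 2 Y)) (hDD Y)))
    (cong (_∨ hDD Y) (sym (hDD-cons a (Z ++ take 2 Y))))))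

  hDD-lead : ∀ p L → (∀ {b c r} → L ≡ b ∷ c ∷ r → p ≤ b) → hDD (p ∷ L) ≡ hDD L
  hDD-lead p [] h = refl
  hDD-lead p (b ∷ []) h = refl
  hDD-lead p (b ∷ c ∷ L) h rewrite <ᵇ-false {b} {p} (h refl) = refl

  hDD-0 : ∀ L → hDD (0 ∷ L) ≡ hDD L
  hDD-0 [] = refl
  hDD-0 (b ∷ []) = refl
  hDD-0 (b ∷ c ∷ L) = refl

  hDD-asc : ∀ {p q} Z → p < q → hDD (Z ++ p ∷ q ∷ []) ≡ hDD (Z ++ p ∷ [])
  hDD-asc [] lt = refl
  hDD-asc {p} {q} (a ∷ []) lt rewrite <ᵇ-false {q} {p} (<⇒≤ lt) with p <ᵇ a
  ... | true = refl
  ... | false = refl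
  hDD-asc {p} {q} (a ∷ b ∷ Z) lt =
    trans (hDD-cons a (b ∷ Z ++ p ∷ q ∷ []))
      (trans (cong₂ _∨_ (st Z) (hDD-asc (b ∷ Z) lt)) (sym (hDD-cons a (b ∷ Z ++ p ∷ []))))
    where
    st : ∀ Z → start a (b ∷ Z ++ p ∷ q ∷ []) ≡ start a (b ∷ Z ++ p ∷ [])
    st [] = refl
    st (c ∷ Z) = refl

  hDD-desc : ∀ {p q} z Z → (∀ {x} → x ∈ z ∷ Z → p < x) → q < p → hDD (z ∷ Z ++ p ∷ q ∷ []) ≡ true
  hDD-desc {p} {q} z [] h lt rewrite <ᵇ-true (h (here refl)) | <ᵇ-true lt = refl
  hDD-desc {p} {q} z (z' ∷ Z) h lt =
    trans (hDD-cons z (z' ∷ Z ++ p ∷ q ∷ []))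
      (trans (cong (start z (z' ∷ Z ++ p ∷ q ∷ []) ∨_) (hDD-desc z' Z (λ pr → h (there pr)) lt)) (∨-zeroʳ _))

  hDD-map : ∀ {f} → Increasing f → ∀ L → hDD (map f L) ≡ hDD L
  hDD-map sm [] = refl
  hDD-map sm (a ∷ []) = refl
  hDD-map sm (a ∷ b ∷ []) = refl
  hDD-map {f} sm (a ∷ b ∷ c ∷ L) = cong₂ _∨_ (cong₂ _∧_ (increasing-<ᵇ sm b a) (increasing-<ᵇ sm c b)) (hDD-map sm (b ∷ c ∷ L))

  -- A word is simsun if no restriction to the letters below some k has a double
  -- descent (for a permutation of [0..n) this is the simsun property of Defs).
  Simsun : List ℕ → Set
  Simsun w = ∀ k → hDD (restrict k w) ≡ false

  SameRestrictions : List ℕ → List ℕ → Set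
  SameRestrictions A B = ∀ k → hDD (restrict k A) ≡ hDD (restrict k B)

  simsun-transfer : ∀ {A B} → SameRestrictions A B → Simsun A → Simsun B
  simsun-transfer same s k = trans (sym (same k)) (s k)

  simsun-short : ∀ L → length L ≤ 2 → Simsun L
  simsun-short L l k = hDD-short (restrict k L) (≤-trans (restrict-length k L) l)

  -- Block decomposition: if X lies above Y, a restriction of X ++ Y either
  -- misses X entirely or contains all of Y.  Hence X ++ Y is simsun iff Y and
  -- X ++ (first two letters of Y) are.
  block-restrictions : ∀ X Y → Above X Y → ∀ k → hDD (restrict k (X ++ Y)) ≡ hDD (restrict k (X ++ take 2 Y)) ∨ hDD (restrict k Y)
  block-restrictions X Y above k with all-≥-or-some-< k X
  ... | inj₁ X≥k = begin
    hDD (restrict k (X ++ Y))                        ≡⟨ cong hDD (misses Y) ⟩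
    hDD (restrict k Y)                               ≡⟨ cong (_∨ hDD (restrict k Y)) (sym short) ⟩
    hDD (restrict k (take 2 Y)) ∨ hDD (restrict k Y) ≡⟨ cong (λ t → hDD t ∨ hDD (restrict k Y)) (sym (misses (take 2 Y))) ⟩
    hDD (restrict k (X ++ take 2 Y)) ∨ hDD (restrict k Y) ∎
    where
    open ≡-Reasoning
    misses : ∀ Z → restrict k (X ++ Z) ≡ restrict k Z
    misses Z = trans (restrict-++ k X Z) (cong (_++ restrict k Z) (restrict-none k X X≥k))
    short : hDD (restrict k (take 2 Y)) ≡ false
    short = hDD-short (restrict k (take 2 Y)) (≤-trans (restrict-length k (take 2 Y)) (take2-short Y))
  ... | inj₂ (x , x∈X , x<k) = begin
    hDD (restrict k (X ++ Y))                             ≡⟨ cong hDD (contains Y (λ y∈ → y∈)) ⟩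
    hDD (restrict k X ++ Y)                               ≡⟨ hDD-++ (restrict k X) Y ⟩
    hDD (restrict k X ++ take 2 Y) ∨ hDD Y
      ≡⟨ cong₂ (λ s t → hDD s ∨ hDD t) (sym (contains (take 2 Y) (take2-⊆ Y))) (sym (all-of Y (λ y∈ → y∈))) ⟩
    hDD (restrict k (X ++ take 2 Y)) ∨ hDD (restrict k Y) ∎
    where
    open ≡-Reasoning
    all-of : ∀ Z → (∀ {z} → z ∈ Z → z ∈ Y) → restrict k Z ≡ Z
    all-of Z Z⊆Y = restrict-all k Z (λ z∈ → <-trans (above x∈X (Z⊆Y z∈)) x<k)
    contains : ∀ Z → (∀ {z} → z ∈ Z → z ∈ Y) → restrict k (X ++ Z) ≡ restrict k X ++ Z
    contains Z Z⊆Y = trans (restrict-++ k X Z) (cong (restrict k X ++_) (all-of Z Z⊆Y))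

  simsun-block⇒ : ∀ X Y → Above X Y → Simsun (X ++ Y) → Simsun Y × Simsun (X ++ take 2 Y)
  simsun-block⇒ X Y above s =
    (λ k → ∨-conicalʳ _ _ (trans (sym (block-restrictions X Y above k)) (s k))) ,
    (λ k → ∨-conicalˡ _ _ (trans (sym (block-restrictions X Y above k)) (s k)))

  simsun-block⇐ : ∀ X Y → Above X Y → Simsun Y → Simsun (X ++ take 2 Y) → Simsun (X ++ Y)
  simsun-block⇐ X Y above sY sX k = trans (block-restrictions X Y above k) (cong₂ _∨_ (sX k) (sY k))

  -- Simsun words are invariant under increasing relabellings: for each bound K
  -- on the new letters there is a corresponding bound k' on the old ones.
  module _ {f : ℕ → ℕ} (inc : Increasing f) where
    Threshold : ℕ → ℕ → Set
    Threshold K k' = ∀ z → (f z < K → z < k') × (z < k' → f z < K)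

    threshold : ∀ K → Σ ℕ (Threshold K)
    threshold zero = 0 , λ z → (λ ()) , (λ ())
    threshold (suc K) with threshold K
    ... | k' , h with f k' ≟ K
    ... | yes e = suc k' , λ z → fw z , bw z
      where
      fw : ∀ z → f z < suc K → z < suc k'
      fw z lt with m≤n⇒m<n∨m≡n (≤-pred lt)
      ... | inj₁ l = m≤n⇒m≤1+n (proj₁ (h z) l)
      ... | inj₂ e' = s≤s (≤-reflexive (increasing-injective inc (trans e' (sym e))))
      bw : ∀ z → z < suc k' → f z < suc K
      bw z lt with m≤n⇒m<n∨m≡n (≤-pred lt)
      ... | inj₁ l = m≤n⇒m≤1+n (proj₂ (h z) l)
      ... | inj₂ refl = s≤s (≤-reflexive e)
    ... | no ne = k' , λ z → fw z , (λ l → m≤n⇒m≤1+n (proj₂ (h z) l))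
      where
      fk' : K ≤ f k'
      fk' = ≮⇒≥ (λ l → <-irrefl refl (proj₁ (h k') l))
      fw : ∀ z → f z < suc K → z < k'
      fw z lt with m≤n⇒m<n∨m≡n (≤-pred lt)
      ... | inj₁ l = proj₁ (h z) l
      ... | inj₂ e' with <-cmp z k'
      ... | tri< a _ _ = a
      ... | tri≈ _ refl _ = ⊥-elim (ne e')
      ... | tri> _ _ c = ⊥-elim (<-irrefl refl (<-≤-trans (inc c) (subst (_≤ f k') (sym e') fk')))

    restrict-map : ∀ {K k'} → Threshold K k' → ∀ Z → restrict K (map f Z) ≡ map f (restrict k' Z)
    restrict-map h [] = refl
    restrict-map {K} {k'} h (z ∷ Z) with restrict-cons {K} (f z) (map f Z) | restrict-cons {k'} z Z
    ... | inj₁ (_ , e1) | inj₁ (_ , e2) = trans e1 (trans (cong (f z ∷_) (restrict-map h Z)) (cong (map f) (sym e2)))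
    ... | inj₂ (_ , e1) | inj₂ (_ , e2) = trans e1 (trans (restrict-map h Z) (cong (map f) (sym e2)))
    ... | inj₁ (lt , _) | inj₂ (ge , _) = ⊥-elim (<-irrefl refl (<-≤-trans (proj₁ (h z) lt) ge))
    ... | inj₂ (ge , _) | inj₁ (lt , _) = ⊥-elim (<-irrefl refl (<-≤-trans (proj₂ (h z) lt) ge))

    simsun-map⇐ : ∀ Z → Simsun Z → Simsun (map f Z)
    simsun-map⇐ Z s K with threshold K
    ... | k' , h = trans (cong hDD (restrict-map h Z)) (trans (hDD-map inc (restrict k' Z)) (s k'))

    simsun-map⇒ : ∀ Z → Simsun (map f Z) → Simsun Z
    simsun-map⇒ Z s zero = trans (sym (trans (cong hDD (restrict-map (λ z → (λ ()) , (λ ())) Z)) (hDD-map inc (restrict 0 Z)))) (s 0)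
    simsun-map⇒ Z s (suc j) = trans (sym (trans (cong hDD (restrict-map h Z)) (hDD-map inc (restrict (suc j) Z)))) (s (suc (f j)))
      where
      h : Threshold (suc (f j)) (suc j)
      h z = (λ l → s≤s (increasing-reflects-≤ inc (≤-pred l))) , (λ l → s≤s (increasing-≤ inc (≤-pred l)))

  simsun-shift⇒ : ∀ c Z → Simsun (map (c +_) Z) → Simsun Z
  simsun-shift⇒ c Z = simsun-map⇒ (+-increasing c) Z

  simsun-shift⇐ : ∀ c Z → Simsun Z → Simsun (map (c +_) Z)
  simsun-shift⇐ c Z = simsun-map⇐ (+-increasing c) Z

  -- A word followed by a smaller letter t, relabelled: the shape of 'Simsun⁺'.
  tail : ℕ → ℕ → ℕ → ℕ
  tail t c zero = t
  tail t c (suc i) = c + i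

  tail-increasing : ∀ {t c} → t < c → Increasing (tail t c)
  tail-increasing {t} {c} tc {zero} {suc y} lt = <-≤-trans tc (m≤m+n c y)
  tail-increasing {t} {c} tc {suc x} {suc y} lt = +-monoʳ-< c (≤-pred lt)

  map-tail : ∀ t c Z → map (tail t c) (map suc Z ++ 0 ∷ []) ≡ map (c +_) Z ++ t ∷ []
  map-tail t c Z = trans (map-++ (tail t c) (map suc Z) (0 ∷ [])) (cong (_++ t ∷ []) (sym (map-∘ Z)))

  simsun-tail⇒ : ∀ {t c} Z → t < c → Simsun (map (c +_) Z ++ t ∷ []) → Simsun (map suc Z ++ 0 ∷ [])
  simsun-tail⇒ {t} {c} Z tc s = simsun-map⇒ (tail-increasing tc) (map suc Z ++ 0 ∷ []) (subst Simsun (sym (map-tail t c Z)) s)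

  simsun-tail⇐ : ∀ {t c} Z → t < c → Simsun (map suc Z ++ 0 ∷ []) → Simsun (map (c +_) Z ++ t ∷ [])
  simsun-tail⇐ {t} {c} Z tc s = subst Simsun (map-tail t c Z) (simsun-map⇐ (tail-increasing tc) (map suc Z ++ 0 ∷ []) s)

  lead-restrictions : ∀ p X Y → (∀ {x} → x ∈ X → p < x) → length Y ≤ 1 →
    ∀ k → hDD (restrict k (p ∷ X ++ Y)) ≡ hDD (restrict k (X ++ Y))
  lead-restrictions p X Y hX lY k with restrict-cons {k} p (X ++ Y)
  ... | inj₂ (_ , e) = cong hDD e
  ... | inj₁ (_ , e) = trans (cong hDD e) (hDD-lead p (restrict k (X ++ Y)) hh)
    where
    hh : ∀ {b c r} → restrict k (X ++ Y) ≡ b ∷ c ∷ r → p ≤ b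
    hh {b} {c} {r} e' with restrict k X in eX
    ... | x ∷ rX = <⇒≤ (hX (proj₁ (restrict-∈ X (subst (b ∈_) (sym eX) (here (cong-head e''))))))
      where
      e'' : x ∷ rX ++ restrict k Y ≡ b ∷ c ∷ r
      e'' = trans (sym (trans (restrict-++ k X Y) (cong (_++ restrict k Y) eX))) e'
      cong-head : ∀ {a a' : ℕ} {l l'} → a ∷ l ≡ a' ∷ l' → a' ≡ a
      cong-head refl = refl
    ... | [] = ⊥-elim (len (trans (sym (trans (restrict-++ k X Y) (cong (_++ restrict k Y) eX))) e'))
      where
      len : restrict k Y ≢ b ∷ c ∷ r
      len e2 with ≤-trans (≤-reflexive (cong length (sym e2))) (≤-trans (restrict-length k Y) lY)
      ... | s≤s ()

  simsun-lead⇒ : ∀ p X Y → (∀ {x} → x ∈ X → p < x) → length Y ≤ 1 → Simsun (p ∷ X ++ Y) → Simsun (X ++ Y)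
  simsun-lead⇒ p X Y h l = simsun-transfer {p ∷ X ++ Y} {X ++ Y} (lead-restrictions p X Y h l)

  simsun-lead⇐ : ∀ p X Y → (∀ {x} → x ∈ X → p < x) → length Y ≤ 1 → Simsun (X ++ Y) → Simsun (p ∷ X ++ Y)
  simsun-lead⇐ p X Y h l = simsun-transfer {X ++ Y} {p ∷ X ++ Y} (sym ∘ lead-restrictions p X Y h l)

  zero-restrictions : ∀ Z k → hDD (restrict k (0 ∷ Z)) ≡ hDD (restrict k Z)
  zero-restrictions Z zero = refl
  zero-restrictions Z (suc k) = hDD-0 (restrict (suc k) Z)

  simsun-zero⇒ : ∀ Z → Simsun (0 ∷ Z) → Simsun Z
  simsun-zero⇒ Z = simsun-transfer {0 ∷ Z} {Z} (zero-restrictions Z)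

  simsun-zero⇐ : ∀ Z → Simsun Z → Simsun (0 ∷ Z)
  simsun-zero⇐ Z = simsun-transfer {Z} {0 ∷ Z} (sym ∘ zero-restrictions Z)

  ascent-restrictions : ∀ {p q} X → p < q → (∀ {x} → x ∈ X → q < x) →
    ∀ k → hDD (restrict k (X ++ p ∷ q ∷ [])) ≡ hDD (restrict k (X ++ p ∷ []))
  ascent-restrictions {p} {q} X pq hX k with compare-<ᵇ p k | compare-<ᵇ q k
  ... | _ | inj₁ (qk , _) =
    trans (cong hDD (trans (restrict-++ k X (p ∷ q ∷ [])) (cong (restrict k X ++_) (restrict-all k (p ∷ q ∷ []) al))))
    (trans (hDD-asc (restrict k X) pq)
    (cong hDD (sym (trans (restrict-++ k X (p ∷ [])) (cong (restrict k X ++_) (restrict-all k (p ∷ []) (λ { (here refl) → <-trans pq qk })))))))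
    where
    al : ∀ {z} → z ∈ p ∷ q ∷ [] → z < k
    al (here refl) = <-trans pq qk
    al (there (here refl)) = qk
  ... | inj₁ (pk , _) | inj₂ (kq , _) =
    cong hDD (trans (restrict-++ k X (p ∷ q ∷ [])) (trans (cong (restrict k X ++_) (trans (restrict-keep (q ∷ []) pk) (cong (p ∷_) (restrict-drop [] kq))))
      (sym (trans (restrict-++ k X (p ∷ [])) (cong (restrict k X ++_) (restrict-keep [] pk))))))
  ... | inj₂ (kp , _) | inj₂ (kq , _) =
    cong hDD (trans (restrict-++ k X (p ∷ q ∷ [])) (trans (cong (restrict k X ++_) (trans (restrict-drop (q ∷ []) kp) (restrict-drop [] kq)))
      (sym (trans (restrict-++ k X (p ∷ [])) (cong (restrict k X ++_) (restrict-drop [] kp))))))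

  simsun-ascent⇒ : ∀ {p q} X → p < q → (∀ {x} → x ∈ X → q < x) → Simsun (X ++ p ∷ q ∷ []) → Simsun (X ++ p ∷ [])
  simsun-ascent⇒ {p} {q} X p<q above = simsun-transfer {X ++ p ∷ q ∷ []} {X ++ p ∷ []} (ascent-restrictions X p<q above)

  simsun-ascent⇐ : ∀ {p q} X → p < q → (∀ {x} → x ∈ X → q < x) → Simsun (X ++ p ∷ []) → Simsun (X ++ p ∷ q ∷ [])
  simsun-ascent⇐ {p} {q} X p<q above = simsun-transfer {X ++ p ∷ []} {X ++ p ∷ q ∷ []} (sym ∘ ascent-restrictions X p<q above)

  simsun-descent : ∀ {p q} x X → (∀ {z} → z ∈ x ∷ X → p < z) → q < p → Simsun (x ∷ X ++ p ∷ q ∷ []) → ⊥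
  simsun-descent {p} {q} x X hX qp s with trans (sym (s (suc x))) e
    where
    px : p < suc x
    px = <-trans (hX (here refl)) (n<1+n x)
    e : hDD (restrict (suc x) (x ∷ X ++ p ∷ q ∷ [])) ≡ true
    e = trans (cong hDD (trans (restrict-keep (X ++ p ∷ q ∷ []) (n<1+n x)) (cong (x ∷_) (trans (restrict-++ (suc x) X (p ∷ q ∷ []))
          (cong (restrict (suc x) X ++_) (restrict-all (suc x) (p ∷ q ∷ []) (λ { (here refl) → px ; (there (here refl)) → <-trans qp px })))))))
          (hDD-desc x (restrict (suc x) X) (λ { (here refl) → hX (here refl) ; (there pr) → hX (there (proj₁ (restrict-∈ X pr))) }) qp)
  ... | ()

-- Positions and inverse permutations.
module Inverses where

  open import Defs using (position; inverseLine; restrict)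
  open Permutations
  open SimsunWords
  open import Data.Bool using (true; false; T)
  open import Data.Nat using (ℕ; zero; suc; _+_; _≤_; _<_; z≤n; s≤s; _≡ᵇ_)
  open import Data.Nat.Properties
  open import Data.List using (List; []; _∷_; _++_; map; length; upTo; applyUpTo)
  open import Data.List.Properties using (map-upTo; map-∘; map-cong-local; map-++; length-map; ++-assoc)
  open import Data.List.Membership.Propositional using (_∈_; _∉_)
  open import Data.List.Membership.Propositional.Properties using (∈-map⁺; ∈-map⁻; ∈-++⁺ˡ; ∈-++⁺ʳ; ∈-++⁻; ∈-upTo⁻; ∈-∃++)
  open import Data.List.Relation.Unary.Any using (here; there)
  open import Data.List.Relation.Unary.All using (tabulate)
  open import Data.Product using (_×_; _,_; proj₁)
  open import Data.Sum using (_⊎_; inj₁; inj₂)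
  open import Data.Empty using (⊥-elim)
  open import Data.Unit using (tt)
  open import Relation.Binary.PropositionalEquality using (_≡_; refl; sym; trans; cong; cong₂; subst; subst₂; _≢_; module ≡-Reasoning)
  open import Function using (_∘_)

  compare-≡ᵇ : ∀ a b → (a ≡ b × (a ≡ᵇ b) ≡ true) ⊎ (a ≢ b × (a ≡ᵇ b) ≡ false)
  compare-≡ᵇ a b with a ≡ᵇ b in e
  ... | true = inj₁ (≡ᵇ⇒≡ a b (subst T (sym e) tt) , refl)
  ... | false = inj₂ ((λ q → subst T e (≡⇒≡ᵇ a b q)) , refl)

  ≡ᵇ-refl : ∀ a → (a ≡ᵇ a) ≡ true
  ≡ᵇ-refl a with compare-≡ᵇ a a
  ... | inj₁ (_ , e) = e
  ... | inj₂ (a≢a , _) = ⊥-elim (a≢a refl)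

  ≡ᵇ-false : ∀ {a b} → a ≢ b → (a ≡ᵇ b) ≡ false
  ≡ᵇ-false {a} {b} a≢b with compare-≡ᵇ a b
  ... | inj₁ (a≡b , _) = ⊥-elim (a≢b a≡b)
  ... | inj₂ (_ , e) = e

  pos-here : ∀ x xs → position x (x ∷ xs) ≡ 0
  pos-here x xs rewrite ≡ᵇ-refl x = refl

  pos-there : ∀ {j x} xs → j ≢ x → position j (x ∷ xs) ≡ suc (position j xs)
  pos-there {j} {x} xs j≢x rewrite ≡ᵇ-false j≢x = refl

  pos-++-∉ : ∀ {j} X Y → j ∉ X → position j (X ++ Y) ≡ length X + position j Y
  pos-++-∉ [] Y n = refl
  pos-++-∉ {j} (x ∷ X) Y n = trans (pos-there (X ++ Y) (λ e → n (here e))) (cong suc (pos-++-∉ X Y (λ p → n (there p))))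

  pos-++-∈ : ∀ {j} X Y → j ∈ X → position j (X ++ Y) ≡ position j X
  pos-++-∈ {j} (x ∷ X) Y p with compare-≡ᵇ j x
  ... | inj₁ (refl , _) = trans (pos-here j (X ++ Y)) (sym (pos-here j X))
  ... | inj₂ (n , _) with p
  ... | here e = ⊥-elim (n e)
  ... | there q = trans (pos-there (X ++ Y) n) (trans (cong suc (pos-++-∈ X Y q)) (sym (pos-there X n)))

  pos-map : ∀ (f : ℕ → ℕ) → (∀ {x y} → f x ≡ f y → x ≡ y) → ∀ j Z → position (f j) (map f Z) ≡ position j Z
  pos-map f inj j [] = refl
  pos-map f inj j (z ∷ Z) with compare-≡ᵇ j z
  ... | inj₁ (refl , _) = trans (pos-here (f j) (map f Z)) (sym (pos-here j Z))
  ... | inj₂ (n , _) = trans (pos-there (map f Z) (λ e → n (inj e))) (trans (cong suc (pos-map f inj j Z)) (sym (pos-there Z n)))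

  pos-bound : ∀ {j} Z → j ∈ Z → position j Z < length Z
  pos-bound {j} (z ∷ Z) p with compare-≡ᵇ j z
  ... | inj₁ (refl , _) = subst (_< suc (length Z)) (sym (pos-here j Z)) (s≤s z≤n)
  ... | inj₂ (n , _) with p
  ... | here e = ⊥-elim (n e)
  ... | there q = subst (_< suc (length Z)) (sym (pos-there Z n)) (s≤s (pos-bound Z q))

  inv-bound : ∀ {n w} → Perm n w → ∀ {x} → x ∈ inverseLine n w → x < n
  inv-bound {n} {w} p q with ∈-map⁻ _ q
  ... | j , j∈ , refl = subst (position j w <_) (perm-length p) (pos-bound w (pcover p (∈-upTo⁻ j∈)))

  -- In  node α β  (with |α| = a, |β| = b) the letter 0 is
  -- at position a, the letter i + 1 of the β-block at position a + 1 + β⁻¹(i),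
  -- and the letter b + 1 + i of the α-block at position α⁻¹(i).
  module _ {a b α β} (pα : Perm a α) (pβ : Perm b β) where
    private
      A = map (suc (length β) +_) α
      B = map suc β

      length-A : length A ≡ a
      length-A = trans (length-map (suc (length β) +_) α) (perm-length pα)

      0∉A : 0 ∉ A
      0∉A p with ∈-map⁻ _ p
      ... | _ , _ , ()

    position-node-0 : position 0 (node α β) ≡ a
    position-node-0 = begin
      position 0 (A ++ 0 ∷ B)   ≡⟨ pos-++-∉ A (0 ∷ B) 0∉A ⟩
      length A + position 0 (0 ∷ B) ≡⟨ cong (length A +_) (pos-here 0 B) ⟩
      length A + 0              ≡⟨ +-identityʳ _ ⟩
      length A                  ≡⟨ length-A ⟩
      a                         ∎
      where open ≡-Reasoning

    position-node-β : ∀ {i} → i < b → position (suc i) (node α β) ≡ suc a + position i β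
    position-node-β {i} i<b = begin
      position (suc i) (A ++ 0 ∷ B)       ≡⟨ pos-++-∉ A (0 ∷ B) i+1∉A ⟩
      length A + position (suc i) (0 ∷ B) ≡⟨ cong₂ _+_ length-A (pos-there {suc i} {0} B (λ ())) ⟩
      a + suc (position (suc i) B)        ≡⟨ cong (λ t → a + suc t) (pos-map suc suc-injective i β) ⟩
      a + suc (position i β)              ≡⟨ +-suc a _ ⟩
      suc a + position i β                ∎
      where
      open ≡-Reasoning
      i+1∉A : suc i ∉ A
      i+1∉A p with ∈-map⁻ _ p
      ... | i' , _ , e = <-irrefl (suc-injective e)
        (<-≤-trans i<b (subst (_≤ length β + i') (perm-length pβ) (m≤m+n (length β) i')))

    position-node-α : ∀ {i} → i < a → position (suc (b + i)) (node α β) ≡ position i α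
    position-node-α {i} i<a = begin
      position (suc (b + i)) (A ++ 0 ∷ B)           ≡⟨ cong (λ t → position (suc (t + i)) (A ++ 0 ∷ B)) (sym (perm-length pβ)) ⟩
      position (suc (length β) + i) (A ++ 0 ∷ B)   ≡⟨ pos-++-∈ A (0 ∷ B) (∈-map⁺ (suc (length β) +_) (pcover pα i<a)) ⟩
      position (suc (length β) + i) A              ≡⟨ pos-map (suc (length β) +_) (+-cancelˡ-≡ (suc (length β)) _ _) i α ⟩
      position i α                                 ∎
      where open ≡-Reasoning

    inv-node : inverseLine (a + suc b) (node α β) ≡ a ∷ map (suc a +_) (inverseLine b β) ++ inverseLine a α
    inv-node = begin
      map (λ j → position j (node α β)) (upTo (a + suc b))
        ≡⟨ cong (map (λ j → position j (node α β))) (upTo-split a b) ⟩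
      position 0 (node α β) ∷ map (λ j → position j (node α β)) (map suc (upTo b) ++ map (λ i → suc (b + i)) (upTo a))
        ≡⟨ cong₂ _∷_ position-node-0 (map-++ _ (map suc (upTo b)) _) ⟩
      a ∷ map (λ j → position j (node α β)) (map suc (upTo b)) ++ map (λ j → position j (node α β)) (map (λ i → suc (b + i)) (upTo a))
        ≡⟨ cong (a ∷_) (cong₂ _++_ βpart αpart) ⟩
      a ∷ map (suc a +_) (inverseLine b β) ++ inverseLine a α ∎
      where
      open ≡-Reasoning
      βpart : map (λ j → position j (node α β)) (map suc (upTo b)) ≡ map (suc a +_) (inverseLine b β)
      βpart = trans (sym (map-∘ (upTo b))) (trans (map-cong-local (tabulate (position-node-β ∘ ∈-upTo⁻))) (map-∘ (upTo b)))
      αpart : map (λ j → position j (node α β)) (map (λ i → suc (b + i)) (upTo a)) ≡ inverseLine a α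
      αpart = trans (sym (map-∘ (upTo a))) (map-cong-local (tabulate (position-node-α ∘ ∈-upTo⁻)))
      upTo-split : ∀ a b → upTo (a + suc b) ≡ 0 ∷ map suc (upTo b) ++ map (λ i → suc (b + i)) (upTo a)
      upTo-split a b rewrite +-suc a b | +-comm a b =
        cong (0 ∷_) (trans (applyUpTo-+ suc b a) (cong₂ _++_ (sym (map-upTo suc b)) (sym (map-upTo (λ i → suc (b + i)) a))))
        where
        applyUpTo-+ : ∀ (f : ℕ → ℕ) m n → applyUpTo f (m + n) ≡ applyUpTo f m ++ applyUpTo (λ i → f (m + i)) n
        applyUpTo-+ f zero n = refl
        applyUpTo-+ f (suc m) n = cong (f 0 ∷_) (applyUpTo-+ (λ i → f (suc i)) m n)

  -- If a permutation α of [0..n), n ≥ 2, stays simsun after appending a new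
  -- minimum, then 0 precedes 1 in α: otherwise the extended word restricted to
  -- the letters below 3 is the double descent 2 1 0.
  zero-before-one : ∀ {a α} → Perm (suc (suc a)) α → Simsun (map suc α ++ 0 ∷ []) → position 0 α < position 1 α
  zero-before-one {a} {α} pα s with ∈-∃++ (pcover pα (s≤s z≤n))
  ... | u , v , refl with dist-++⁻ u (0 ∷ v) (pdist pα)
  ... | _ , (0∉v , _) , disj with ∈-++⁻ u (pcover pα (s≤s (s≤s z≤n)))
  ... | inj₂ (there 1∈v) =
    subst₂ _<_ (sym (trans (pos-++-∉ u (0 ∷ v) 0∉u) (trans (cong (length u +_) (pos-here 0 v)) (+-identityʳ _))))
      (sym (trans (pos-++-∉ u (0 ∷ v) (λ 1∈u → disj 1∈u (there 1∈v))) (cong (length u +_) (pos-there {1} {0} v (λ ())))))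
      (subst (length u <_) (sym (+-suc (length u) _)) (s≤s (m≤m+n (length u) _)))
    where
    0∉u : 0 ∉ u
    0∉u 0∈u = disj 0∈u (here refl)
  ... | inj₁ 1∈u with ∈-∃++ 1∈u
  ... | u1 , u2 , refl with dist-++⁻ u1 (1 ∷ u2) (proj₁ (dist-++⁻ (u1 ++ 1 ∷ u2) (0 ∷ v) (pdist pα)))
  ... | _ , (1∉u2 , _) , disj1 with s 3
  ... | dd-free = ⊥-elim (false≢true (trans (sym dd-free) (cong hDD (trans (cong (restrict 3) shape) restricted))))
    where
    false≢true : false ≢ true
    false≢true ()
    large : ∀ {Z} → (∀ {x} → x ∈ Z → x ≢ 0) → (∀ {x} → x ∈ Z → x ≢ 1) → ∀ {y} → y ∈ map suc Z → 3 ≤ y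
    large {Z} ≢0 ≢1 p with ∈-map⁻ _ p
    ... | zero , x∈ , refl = ⊥-elim (≢0 x∈ refl)
    ... | suc zero , x∈ , refl = ⊥-elim (≢1 x∈ refl)
    ... | suc (suc x) , x∈ , refl = s≤s (s≤s (s≤s z≤n))
    shape : map suc ((u1 ++ 1 ∷ u2) ++ 0 ∷ v) ++ 0 ∷ [] ≡ map suc u1 ++ 2 ∷ map suc u2 ++ 1 ∷ map suc v ++ 0 ∷ []
    shape = trans (cong (_++ 0 ∷ []) (trans (map-++ suc (u1 ++ 1 ∷ u2) (0 ∷ v)) (cong (_++ 1 ∷ map suc v) (map-++ suc u1 (1 ∷ u2)))))
      (trans (++-assoc (map suc u1 ++ 2 ∷ map suc u2) (1 ∷ map suc v) (0 ∷ []))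
        (++-assoc (map suc u1) (2 ∷ map suc u2) (1 ∷ map suc v ++ 0 ∷ [])))
    skip-large : ∀ Z W → (∀ {y} → y ∈ map suc Z → 3 ≤ y) → restrict 3 (map suc Z ++ W) ≡ restrict 3 W
    skip-large Z W h = trans (restrict-++ 3 (map suc Z) W) (cong (_++ restrict 3 W) (restrict-none 3 (map suc Z) h))
    restricted : restrict 3 (map suc u1 ++ 2 ∷ map suc u2 ++ 1 ∷ map suc v ++ 0 ∷ []) ≡ 2 ∷ 1 ∷ 0 ∷ []
    restricted = begin
      restrict 3 (map suc u1 ++ 2 ∷ map suc u2 ++ 1 ∷ map suc v ++ 0 ∷ [])
        ≡⟨ skip-large u1 _ (large (λ { x∈ refl → disj (∈-++⁺ˡ x∈) (here refl) }) (λ { x∈ refl → disj1 x∈ (here refl) })) ⟩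
      2 ∷ restrict 3 (map suc u2 ++ 1 ∷ map suc v ++ 0 ∷ [])
        ≡⟨ cong (2 ∷_) (skip-large u2 _ (large (λ { x∈ refl → disj (∈-++⁺ʳ u1 (there x∈)) (here refl) }) (λ { x∈ refl → 1∉u2 x∈ }))) ⟩
      2 ∷ 1 ∷ restrict 3 (map suc v ++ 0 ∷ [])
        ≡⟨ cong (λ t → 2 ∷ 1 ∷ t)
             (skip-large v _ (large (λ { x∈ refl → 0∉v x∈ }) (λ { x∈ refl → disj (∈-++⁺ʳ u1 (here refl)) (there x∈) }))) ⟩
      2 ∷ 1 ∷ 0 ∷ [] ∎
      where open ≡-Reasoning

-- Subsequences and 213 patterns.
module Avoidance where

  open import Defs using (subsequences)
  open Permutations
  open SimsunWords using (compare-<ᵇ; Increasing; increasing-reflects-<; +-increasing)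
  open import Relation.Nullary using (¬_)
  open import Data.Nat using (ℕ; suc; _+_; _≤_; _<_; z≤n; s≤s)
  open import Data.Nat.Properties
  open import Data.List using (List; []; _∷_; _++_; map; length)
  open import Data.List.Membership.Propositional using (_∈_)
  open import Data.List.Membership.Propositional.Properties using (∈-map⁺; ∈-map⁻; ∈-++⁺ˡ; ∈-++⁺ʳ; ∈-++⁻)
  open import Data.List.Relation.Unary.Any using (here; there)
  open import Data.Product using (Σ; _×_; _,_; proj₂)
  open import Data.Sum using (inj₁; inj₂)
  open import Data.Empty using (⊥-elim)
  open import Relation.Binary.PropositionalEquality using (_≡_; refl; sym; subst)

  data Sub : List ℕ → List ℕ → Set where
    nil : ∀ {ys} → Sub [] ys
    skip : ∀ {xs y ys} → Sub xs ys → Sub xs (y ∷ ys)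
    keep : ∀ {x xs ys} → Sub xs ys → Sub (x ∷ xs) (x ∷ ys)

  Has213 : List ℕ → Set
  Has213 w = Σ ℕ λ a → Σ ℕ λ b → Σ ℕ λ c → Sub (a ∷ b ∷ c ∷ []) w × b < a × a < c

  Avoids213 : List ℕ → Set
  Avoids213 w = ¬ Has213 w

  sub-nil-∈ : ∀ w → [] ∈ subsequences w
  sub-nil-∈ [] = here refl
  sub-nil-∈ (x ∷ w) = ∈-++⁺ʳ (map (x ∷_) (subsequences w)) (sub-nil-∈ w)

  sub→ss : ∀ {s w} → Sub s w → s ∈ subsequences w
  sub→ss {w = w} nil = sub-nil-∈ w
  sub→ss {w = y ∷ ys} (skip p) = ∈-++⁺ʳ (map (y ∷_) (subsequences ys)) (sub→ss p)
  sub→ss {w = y ∷ ys} (keep p) = ∈-++⁺ˡ (∈-map⁺ (y ∷_) (sub→ss p))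

  ss→sub : ∀ {s} w → s ∈ subsequences w → Sub s w
  ss→sub [] (here refl) = nil
  ss→sub (x ∷ w) p with ∈-++⁻ (map (x ∷_) (subsequences w)) p
  ... | inj₁ q with ∈-map⁻ (x ∷_) q
  ... | s' , q' , refl = keep (ss→sub w q')
  ss→sub (x ∷ w) p | inj₂ q = skip (ss→sub w q)

  sub-∈ : ∀ {s w x} → Sub s w → x ∈ s → x ∈ w
  sub-∈ (skip p) q = there (sub-∈ p q)
  sub-∈ (keep p) (here refl) = here refl
  sub-∈ (keep p) (there q) = there (sub-∈ p q)

  sub-++ : ∀ {s1 s2 X Y} → Sub s1 X → Sub s2 Y → Sub (s1 ++ s2) (X ++ Y)
  sub-++ {X = []} nil q = q
  sub-++ {X = x ∷ X} nil q = skip (sub-++ {X = X} nil q)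
  sub-++ (skip p) q = skip (sub-++ p q)
  sub-++ (keep p) q = keep (sub-++ p q)

  sub-++⁻ : ∀ {s} X Y → Sub s (X ++ Y) → Σ (List ℕ) λ s1 → Σ (List ℕ) λ s2 → s ≡ s1 ++ s2 × Sub s1 X × Sub s2 Y
  sub-++⁻ [] Y p = [] , _ , refl , nil , p
  sub-++⁻ (x ∷ X) Y nil = [] , [] , refl , nil , nil
  sub-++⁻ (x ∷ X) Y (skip p) with sub-++⁻ X Y p
  ... | s1 , s2 , e , p1 , p2 = s1 , s2 , e , skip p1 , p2
  sub-++⁻ (x ∷ X) Y (keep p) with sub-++⁻ X Y p
  ... | s1 , s2 , refl , p1 , p2 = x ∷ s1 , s2 , refl , keep p1 , p2

  sub-map⁺ : ∀ (f : ℕ → ℕ) {s w} → Sub s w → Sub (map f s) (map f w)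
  sub-map⁺ f nil = nil
  sub-map⁺ f (skip p) = skip (sub-map⁺ f p)
  sub-map⁺ f (keep p) = keep (sub-map⁺ f p)

  sub-map⁻ : ∀ (f : ℕ → ℕ) {s} w → Sub s (map f w) → Σ (List ℕ) λ s' → s ≡ map f s' × Sub s' w
  sub-map⁻ f [] nil = [] , refl , nil
  sub-map⁻ f (x ∷ w) nil = [] , refl , nil
  sub-map⁻ f (x ∷ w) (skip p) with sub-map⁻ f w p
  ... | s' , e , q = s' , e , skip q
  sub-map⁻ f (x ∷ w) (keep p) with sub-map⁻ f w p
  ... | s' , refl , q = x ∷ s' , refl , keep q

  sub-trans : ∀ {s t w} → Sub s t → Sub t w → Sub s w
  sub-trans nil q = nil
  sub-trans p (skip q) = skip (sub-trans p q)
  sub-trans (skip p) (keep q) = skip (sub-trans p q)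
  sub-trans (keep p) (keep q) = keep (sub-trans p q)

  sub-refl : ∀ w → Sub w w
  sub-refl [] = nil
  sub-refl (x ∷ w) = keep (sub-refl w)

  sub-++ˡ : ∀ X Y → Sub X (X ++ Y)
  sub-++ˡ X Y = subst (λ t → Sub t (X ++ Y)) (++-identityʳ X) (sub-++ (sub-refl X) (nil {Y}))
    where open import Data.List.Properties using (++-identityʳ)

  sub-++ʳ : ∀ X Y → Sub Y (X ++ Y)
  sub-++ʳ X Y = sub-++ (nil {X}) (sub-refl Y)

  ∈→sub : ∀ {x w} → x ∈ w → Sub (x ∷ []) w
  ∈→sub (here refl) = keep nil
  ∈→sub (there p) = skip (∈→sub p)

  pat-map⁻ : ∀ {f} → Increasing f → ∀ Z → Has213 (map f Z) → Has213 Z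
  pat-map⁻ {f} sm Z (a , b , c , p , ba , ac) with sub-map⁻ f Z p
  ... | a' ∷ b' ∷ c' ∷ [] , refl , q = a' , b' , c' , q , increasing-reflects-< sm ba , increasing-reflects-< sm ac

  pat-map⁺ : ∀ {f} → Increasing f → ∀ Z → Has213 Z → Has213 (map f Z)
  pat-map⁺ {f} sm Z (a , b , c , p , ba , ac) = f a , f b , f c , sub-map⁺ f p , sm ba , sm ac

  pat-sub : ∀ {X W} → Sub X W → Has213 X → Has213 W
  pat-sub s (a , b , c , p , ba , ac) = a , b , c , sub-trans p s , ba , ac

  node-above : ∀ {b α β} → Perm b β → Above (map (suc (length β) +_) α) (0 ∷ map suc β)
  node-above {b} {α} {β} pb p q with ∈-map⁻ _ p
  ... | i , _ , refl with q
  ... | here refl = s≤s z≤n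
  ... | there q' with ∈-map⁻ _ q'
  ... | j , j∈ , refl = s≤s (<-≤-trans (subst (j <_) (sym (perm-length pb)) (pbound pb j∈)) (m≤m+n (length β) i))

  -- node α β avoids 213 iff α and β do: a pattern meeting both blocks would
  -- need a letter of α below a later letter ('av-node', 'av-parts')
  av-node : ∀ {b α β} → Perm b β → Avoids213 α → Avoids213 β → Avoids213 (node α β)
  av-node {b} {α} {β} pb avα avβ (a , b' , c , p , ba , ac) with sub-++⁻ (map (suc (length β) +_) α) (0 ∷ map suc β) p
  ... | [] , _ , refl , p1 , skip q = avβ (pat-map⁻ (+-increasing 1) β (a , b' , c , q , ba , ac))
  ... | [] , _ , refl , p1 , keep q with ba
  ... | ()
  av-node {b} {α} {β} pb avα avβ (a , b' , c , p , ba , ac) | x ∷ [] , _ , refl , p1 , p2 =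
    <-asym ac (node-above {α = α} pb (sub-∈ p1 (here refl)) (sub-∈ p2 (there (here refl))))
  av-node {b} {α} {β} pb avα avβ (a , b' , c , p , ba , ac) | x ∷ y ∷ [] , _ , refl , p1 , p2 =
    <-asym ac (node-above {α = α} pb (sub-∈ p1 (here refl)) (sub-∈ p2 (here refl)))
  av-node {b} {α} {β} pb avα avβ (a , b' , c , p , ba , ac) | x ∷ y ∷ z ∷ [] , [] , refl , p1 , p2 =
    avα (pat-map⁻ (+-increasing (suc (length β))) α (a , b' , c , p1 , ba , ac))

  av-parts : ∀ α β → Avoids213 (node α β) → Avoids213 α × Avoids213 β
  av-parts α β av = (λ pt → av (pat-sub (sub-++ˡ A (0 ∷ B)) (pat-map⁺ (+-increasing (suc (length β))) α pt)))
                  , (λ pt → av (pat-sub (sub-++ʳ A (0 ∷ B)) (pat-sub (skip (sub-refl B)) (pat-map⁺ (+-increasing 1) β pt))))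
    where
    A = map (suc (length β) +_) α
    B = map suc β

  av-above : ∀ u v → Avoids213 (u ++ 0 ∷ v) → Dist (u ++ 0 ∷ v) → Above u v
  av-above u v av d {x} {y} xu yv with compare-<ᵇ y x
  ... | inj₁ (lt , _) = lt
  ... | inj₂ (xy , _) = ⊥-elim (av (x , 0 , y , sub-++ (∈→sub xu) (keep (∈→sub yv)) , 0<x , x<y))
    where
    dd = dist-++⁻ u (0 ∷ v) d
    0<x : 0 < x
    0<x = n≢0⇒n>0 (λ { refl → proj₂ (proj₂ dd) xu (here refl) })
    x<y : x < y
    x<y with m≤n⇒m<n∨m≡n xy
    ... | inj₁ l = l
    ... | inj₂ refl = ⊥-elim (proj₂ (proj₂ dd) xu (there yv))

-- The four classes of 213-avoiding permutations and their decomposition at the minimum.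
module Classes where

  open import Defs using (inverseLine)
  open Permutations
  open SimsunWords
  open Inverses
  open Avoidance
  open import Data.Bool using (Bool; true; false)
  open import Data.Nat using (ℕ; suc; _+_; _≤_; _<_; z≤n; s≤s)
  open import Data.Nat.Properties
  open import Data.List using (List; []; _∷_; _++_; map; length; take)
  open import Data.List.Membership.Propositional using (_∈_)
  open import Data.List.Membership.Propositional.Properties using (∈-map⁻; ∈-++⁻; ∈-∃++)
  open import Data.List.Relation.Unary.Any using (here; there)
  open import Data.Product using (_×_; _,_; proj₁; proj₂)
  open import Data.Sum using (inj₁; inj₂)
  open import Data.Empty using (⊥; ⊥-elim)
  open import Data.Unit using (⊤; tt)
  open import Data.List.Properties using (map-++; map-∘; ++-assoc; ++-identityʳ)
  open import Relation.Binary.PropositionalEquality using (_≡_; refl; sym; trans; cong; cong₂; subst)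

  -- The recursion on 213-avoiding
  -- permutations needs this stronger property for the left block.
  Simsun⁺ : Bool → List ℕ → Set
  Simsun⁺ false w = Simsun w
  Simsun⁺ true w = Simsun (map suc w ++ 0 ∷ [])

  ∈-shift⇒≥ : ∀ {c x} Z → x ∈ map (c +_) Z → c ≤ x
  ∈-shift⇒≥ {c} Z p with ∈-map⁻ _ p
  ... | i , _ , refl = m≤m+n c i

  -- For x = true the block α may not be followed directly
  -- by the new minimum: if β = [] and α ≠ [], the word ends with  α 0 ⋆  where
  -- ⋆ is the new minimum, a double descent.
  NoTailDescent : Bool → List ℕ → List ℕ → Set
  NoTailDescent true (_ ∷ _) [] = ⊥
  NoTailDescent _ _ _ = ⊤

  -- The proofs split  node α β  (extended by the new minimum if x = true)
  -- into the block α above the rest ('simsun-block⇒/⇐') and reduce the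
  -- first two letters of the rest by the local moves of SimsunWords.
  module SimsunNode {b : ℕ} (α β : List ℕ) (pb : Perm b β) where
    lβ = length β
    A = map (suc lβ +_) α
    B = map suc β
    ab : Above A (0 ∷ B)
    ab = node-above {α = α} pb
    jβ : ∀ {j} → j ∈ β → j < lβ
    jβ j∈ = subst (_ <_) (sym (perm-length pb)) (pbound pb j∈)
    A>B : ∀ {j} → j ∈ β → ∀ {x} → x ∈ A → suc j < x
    A>B j∈ p = <-≤-trans (s≤s (jβ j∈)) (∈-shift⇒≥ α p)

    plain⇒ : Simsun (node α β) → Simsun⁺ true α × Simsun β
    plain⇒ s with simsun-block⇒ A (0 ∷ B) ab s
    ... | s0B , sX = prefix β refl sX , simsun-shift⇒ 1 β (simsun-zero⇒ B s0B)
      where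
      prefix : ∀ β' → β' ≡ β → Simsun (A ++ take 2 (0 ∷ map suc β')) → Simsun⁺ true α
      prefix [] refl s' = simsun-tail⇒ α (s≤s z≤n) s'
      prefix (j ∷ β') refl s' = simsun-tail⇒ α (s≤s z≤n) (simsun-ascent⇒ A (s≤s z≤n) (A>B (here refl)) s')

    plain⇐ : Simsun⁺ true α → Simsun β → Simsun (node α β)
    plain⇐ fα sβ = simsun-block⇐ A (0 ∷ B) ab (simsun-zero⇐ B (simsun-shift⇐ 1 β sβ)) (prefix β refl)
      where
      prefix : ∀ β' → β' ≡ β → Simsun (A ++ take 2 (0 ∷ map suc β'))
      prefix [] refl = simsun-tail⇐ α (s≤s z≤n) fα
      prefix (j ∷ β') refl = simsun-ascent⇐ A (s≤s z≤n) (A>B (here refl)) (simsun-tail⇐ α (s≤s z≤n) fα)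

    X1 = map (suc (suc lβ) +_) α
    Y1 = 1 ∷ map (2 +_) β ++ 0 ∷ []
    e1 : map suc (node α β) ++ 0 ∷ [] ≡ X1 ++ Y1
    e1 = trans (cong (_++ 0 ∷ []) (trans (map-++ suc A (0 ∷ B)) (cong₂ (λ s t → s ++ 1 ∷ t) (sym (map-∘ α)) (sym (map-∘ β)))))
           (++-assoc X1 (1 ∷ map (2 +_) β) (0 ∷ []))
    ab1 : Above X1 Y1
    ab1 p (here refl) = <-≤-trans (s≤s (s≤s z≤n)) (∈-shift⇒≥ α p)
    ab1 p (there q) with ∈-++⁻ (map (2 +_) β) q
    ... | inj₂ (here refl) = <-≤-trans (s≤s z≤n) (∈-shift⇒≥ α p)
    ... | inj₁ q' with ∈-map⁻ _ q'
    ... | j , j∈ , refl = <-≤-trans (s≤s (s≤s (jβ j∈))) (∈-shift⇒≥ α p)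
    lead1 : ∀ {x} → x ∈ map (2 +_) β → 1 < x
    lead1 p = <-≤-trans (s≤s (s≤s z≤n)) (∈-shift⇒≥ β p)

    extended⇒ : Simsun (map suc (node α β) ++ 0 ∷ []) → Simsun⁺ true α × Simsun⁺ true β × NoTailDescent true α β
    extended⇒ s with simsun-block⇒ X1 Y1 ab1 (subst Simsun e1 s)
    ... | sY , sX =
      proj₁ (prefix α β refl refl sX) ,
      simsun-tail⇒ β (s≤s z≤n) (simsun-lead⇒ 1 (map (2 +_) β) (0 ∷ []) lead1 ≤-refl sY) ,
      proj₂ (prefix α β refl refl sX)
      where
      prefix : ∀ α' β' → α' ≡ α → β' ≡ β → Simsun (map (suc (suc lβ) +_) α' ++ take 2 (1 ∷ map (2 +_) β' ++ 0 ∷ [])) →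
        Simsun⁺ true α' × NoTailDescent true α' β'
      prefix [] [] refl refl s' = simsun-short (map suc [] ++ 0 ∷ []) (s≤s z≤n) , tt
      prefix (i ∷ α') [] refl refl s' = ⊥-elim (simsun-descent (suc (suc lβ) + i) (map (suc (suc lβ) +_) α') (λ q → ab1 q (here refl)) (s≤s z≤n) s')
      prefix α' (j ∷ β') refl refl s' = simsun-tail⇒ α (s≤s (s≤s z≤n)) (simsun-ascent⇒ X1 (s≤s (s≤s z≤n)) (λ p → ab1 p (there (here refl))) s') , nb α
        where
        nb : ∀ α → NoTailDescent true α (j ∷ β')
        nb [] = tt
        nb (_ ∷ _) = tt

    extended⇐ : Simsun⁺ true α → Simsun⁺ true β → NoTailDescent true α β → Simsun (map suc (node α β) ++ 0 ∷ [])
    extended⇐ fα fβ nb =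
      subst Simsun (sym e1)
        (simsun-block⇐ X1 Y1 ab1 (simsun-lead⇐ 1 (map (2 +_) β) (0 ∷ []) lead1 ≤-refl (simsun-tail⇐ β (s≤s z≤n) fβ))
          (prefix α β refl refl nb))
      where
      prefix : ∀ α' β' → α' ≡ α → β' ≡ β → NoTailDescent true α' β' → Simsun (map (suc (suc lβ) +_) α' ++ take 2 (1 ∷ map (2 +_) β' ++ 0 ∷ []))
      prefix [] [] refl refl nb' = simsun-short (1 ∷ 0 ∷ []) (s≤s (s≤s z≤n))
      prefix (_ ∷ _) [] refl refl ()
      prefix α' (j ∷ β') refl refl nb' = simsun-ascent⇐ X1 (s≤s (s≤s z≤n)) (λ p → ab1 p (there (here refl))) (simsun-tail⇐ α (s≤s (s≤s z≤n)) fα)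

  node-simsun⇒ : ∀ x {b} α β → Perm b β → Simsun⁺ x (node α β) → Simsun⁺ true α × Simsun⁺ x β × NoTailDescent x α β
  node-simsun⇒ false α β pb s = let (p , q) = SimsunNode.plain⇒ α β pb s in p , q , tt
  node-simsun⇒ true α β pb s = SimsunNode.extended⇒ α β pb s

  node-simsun⇐ : ∀ x {b} α β → Perm b β → Simsun⁺ true α → Simsun⁺ x β → NoTailDescent x α β → Simsun⁺ x (node α β)
  node-simsun⇐ false α β pb fα fβ _ = SimsunNode.plain⇐ α β pb fα fβ
  node-simsun⇐ true α β pb fα fβ nb = SimsunNode.extended⇐ α β pb fα fβ nb

  -- The inverse is  a (β⁻¹ shifted) α⁻¹
  -- ('inv-node'), so β⁻¹ must satisfy Simsun⁺ with flag 'tailFlag α y': it is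
  -- followed by smaller letters as soon as α is nonempty.
  tailFlag : List ℕ → Bool → Bool
  tailFlag [] y = y
  tailFlag (_ ∷ _) _ = true

  -- if y = true, α⁻¹ must not be a single letter l: the extended inverse
  -- would end with the double descent  a+1 … l+1 ⋆
  NoInverseDescent : Bool → List ℕ → Set
  NoInverseDescent true (_ ∷ []) = ⊥
  NoInverseDescent _ _ = ⊤

  -- α⁻¹ starts with an ascent when α is Simsun⁺ true ('zero-before-one')
  StartsWithAscent : List ℕ → Set
  StartsWithAscent (l1 ∷ l2 ∷ _) = l1 < l2
  StartsWithAscent _ = ⊤

  -- The same analysis for words  a (Bi shifted above a) L  with L below a:
  -- the shape of the inverse of a node, with Bi = β⁻¹ and L = α⁻¹.
  module InverseNode (a : ℕ) (Bi L : List ℕ) (hL : ∀ {l} → l ∈ L → l < a) where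
    H = map (suc a +_) Bi
    hH : ∀ {x} → x ∈ H → a < x
    hH p = ∈-shift⇒≥ Bi p
    ab0 : Above (a ∷ H) L
    ab0 (here refl) q = hL q
    ab0 (there p) q = <-trans (hL q) (hH p)

    plain⇒ : StartsWithAscent L → Simsun (a ∷ H ++ L) → Simsun L × Simsun⁺ (tailFlag L false) Bi
    plain⇒ asc s with simsun-block⇒ (a ∷ H) L ab0 s
    ... | sL , sX = sL , prefix L refl asc sX
      where
      prefix : ∀ L' → L' ≡ L → StartsWithAscent L' → Simsun (a ∷ H ++ take 2 L') → Simsun⁺ (tailFlag L' false) Bi
      prefix [] refl _ s' = simsun-shift⇒ (suc a) Bi (subst Simsun (++-identityʳ H) (simsun-lead⇒ a H [] hH z≤n s'))
      prefix (l ∷ []) refl _ s' = simsun-tail⇒ Bi (s≤s (<⇒≤ (hL (here refl)))) (simsun-lead⇒ a H (l ∷ []) hH ≤-refl s')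
      prefix (l1 ∷ l2 ∷ R) refl as s' =
        simsun-tail⇒ Bi (s≤s (<⇒≤ (hL (here refl)))) (simsun-lead⇒ a H (l1 ∷ []) hH ≤-refl
          (simsun-ascent⇒ (a ∷ H) as (λ p → ab0 p (there (here refl))) s'))

    plain⇐ : StartsWithAscent L → Simsun L → Simsun⁺ (tailFlag L false) Bi → Simsun (a ∷ H ++ L)
    plain⇐ asc sL fB = simsun-block⇐ (a ∷ H) L ab0 sL (prefix L refl asc fB)
      where
      prefix : ∀ L' → L' ≡ L → StartsWithAscent L' → Simsun⁺ (tailFlag L' false) Bi → Simsun (a ∷ H ++ take 2 L')
      prefix [] refl _ f = simsun-lead⇐ a H [] hH z≤n (subst Simsun (sym (++-identityʳ H)) (simsun-shift⇐ (suc a) Bi f))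
      prefix (l ∷ []) refl _ f = simsun-lead⇐ a H (l ∷ []) hH ≤-refl (simsun-tail⇐ Bi (s≤s (<⇒≤ (hL (here refl)))) f)
      prefix (l1 ∷ l2 ∷ R) refl as f =
        simsun-ascent⇐ (a ∷ H) as (λ p → ab0 p (there (here refl)))
          (simsun-lead⇐ a H (l1 ∷ []) hH ≤-refl (simsun-tail⇐ Bi (s≤s (<⇒≤ (hL (here refl)))) f))

    H2 = map (suc (suc a) +_) Bi
    X2 = suc a ∷ H2
    Y2 = map suc L ++ 0 ∷ []
    e2 : map suc (a ∷ H ++ L) ++ 0 ∷ [] ≡ X2 ++ Y2
    e2 = cong (suc a ∷_) (trans (cong (_++ 0 ∷ []) (trans (map-++ suc H L) (cong (_++ map suc L) (sym (map-∘ Bi)))))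
           (++-assoc H2 (map suc L) (0 ∷ [])))
    hH2 : ∀ {x} → x ∈ H2 → suc a < x
    hH2 p = ∈-shift⇒≥ Bi p
    ab2 : Above X2 Y2
    ab2 {x} {y} p q with ∈-++⁻ (map suc L) q
    ... | inj₂ (here refl) = <-≤-trans (s≤s z≤n) (xge p)
      where
      xge : ∀ {x} → x ∈ X2 → suc a ≤ x
      xge (here refl) = ≤-refl
      xge (there p) = <⇒≤ (hH2 p)
    ... | inj₁ q' with ∈-map⁻ _ q'
    ... | l , l∈ , refl = <-≤-trans (s≤s (hL l∈)) (xge p)
      where
      xge : ∀ {x} → x ∈ X2 → suc a ≤ x
      xge (here refl) = ≤-refl
      xge (there p) = <⇒≤ (hH2 p)

    extended⇒ : StartsWithAscent L → Simsun (map suc (a ∷ H ++ L) ++ 0 ∷ []) → Simsun⁺ true L × Simsun⁺ (tailFlag L true) Bi × NoInverseDescent true L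
    extended⇒ asc s with simsun-block⇒ X2 Y2 ab2 (subst Simsun e2 s)
    ... | sY , sX = sY , prefix L refl asc sX
      where
      prefix : ∀ L' → L' ≡ L → StartsWithAscent L' → Simsun (X2 ++ take 2 (map suc L' ++ 0 ∷ [])) → Simsun⁺ (tailFlag L' true) Bi × NoInverseDescent true L'
      prefix [] refl _ s' = simsun-tail⇒ Bi (s≤s z≤n) (simsun-lead⇒ (suc a) H2 (0 ∷ []) hH2 ≤-refl s') , tt
      prefix (l ∷ []) refl _ s' =
        ⊥-elim (simsun-descent (suc a) H2 (λ { (here refl) → s≤s (hL (here refl)) ; (there p) → <-trans (s≤s (hL (here refl))) (hH2 p) })
          (s≤s z≤n) s')
      prefix (l1 ∷ l2 ∷ R) refl as s' =
        simsun-tail⇒ Bi (s≤s (s≤s (<⇒≤ (hL (here refl))))) (simsun-lead⇒ (suc a) H2 (suc l1 ∷ []) hH2 ≤-refl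
          (simsun-ascent⇒ X2 (s≤s as) (λ p → ab2 p (there (here refl))) s')) , tt

    extended⇐ : StartsWithAscent L → Simsun⁺ true L → Simsun⁺ (tailFlag L true) Bi → NoInverseDescent true L → Simsun (map suc (a ∷ H ++ L) ++ 0 ∷ [])
    extended⇐ asc fL fB ns = subst Simsun (sym e2) (simsun-block⇐ X2 Y2 ab2 fL (prefix L refl asc fB ns))
      where
      prefix : ∀ L' → L' ≡ L → StartsWithAscent L' → Simsun⁺ (tailFlag L' true) Bi → NoInverseDescent true L' → Simsun (X2 ++ take 2 (map suc L' ++ 0 ∷ []))
      prefix [] refl _ f _ = simsun-lead⇐ (suc a) H2 (0 ∷ []) hH2 ≤-refl (simsun-tail⇐ Bi (s≤s z≤n) f)
      prefix (l ∷ []) refl _ f ()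
      prefix (l1 ∷ l2 ∷ R) refl as f _ =
        simsun-ascent⇐ X2 (s≤s as) (λ p → ab2 p (there (here refl)))
          (simsun-lead⇐ (suc a) H2 (suc l1 ∷ []) hH2 ≤-refl (simsun-tail⇐ Bi (s≤s (s≤s (<⇒≤ (hL (here refl))))) f))

    inverse-simsun⇒ : ∀ y → StartsWithAscent L → Simsun⁺ y (a ∷ H ++ L) → Simsun⁺ y L × Simsun⁺ (tailFlag L y) Bi × NoInverseDescent y L
    inverse-simsun⇒ false asc s = let (p , q) = plain⇒ asc s in p , q , tt
    inverse-simsun⇒ true asc s = extended⇒ asc s

    inverse-simsun⇐ : ∀ y → StartsWithAscent L → Simsun⁺ y L → Simsun⁺ (tailFlag L y) Bi → NoInverseDescent y L → Simsun⁺ y (a ∷ H ++ L)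
    inverse-simsun⇐ false asc fL fB _ = plain⇐ asc fL fB
    inverse-simsun⇐ true asc fL fB ns = extended⇐ asc fL fB ns

  -- The classes of the recursion: 213-avoiding permutations w of [0..n) with
  -- Simsun⁺ x w and Simsun⁺ y w⁻¹.  DRS_n(213) is the class (false , false).
  record Class (x y : Bool) (n : ℕ) (w : List ℕ) : Set where
    constructor mkClass
    field
      class-perm : Perm n w
      class-avoids : Avoids213 w
      class-simsun : Simsun⁺ x w
      class-inverse : Simsun⁺ y (inverseLine n w)
  open Class public

  inverse-starts-with-ascent : ∀ {α} → Perm (length α) α → Simsun⁺ true α → StartsWithAscent (inverseLine (length α) α)
  inverse-starts-with-ascent {[]} p f = tt
  inverse-starts-with-ascent {x ∷ []} p f = tt
  inverse-starts-with-ascent {x ∷ y ∷ r} p f = zero-before-one p f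

  -- α and α⁻¹ are empty together and singletons together
  tailFlag-inverse : ∀ α y → tailFlag (inverseLine (length α) α) y ≡ tailFlag α y
  tailFlag-inverse [] y = refl
  tailFlag-inverse (_ ∷ _) y = refl

  noInverseDescent-inverse⇒ : ∀ y α → NoInverseDescent y (inverseLine (length α) α) → NoInverseDescent y α
  noInverseDescent-inverse⇒ false _ _ = tt
  noInverseDescent-inverse⇒ true [] _ = tt
  noInverseDescent-inverse⇒ true (_ ∷ []) ()
  noInverseDescent-inverse⇒ true (_ ∷ _ ∷ _) _ = tt

  noInverseDescent-inverse⇐ : ∀ y α → NoInverseDescent y α → NoInverseDescent y (inverseLine (length α) α)
  noInverseDescent-inverse⇐ false _ _ = tt
  noInverseDescent-inverse⇐ true [] _ = tt
  noInverseDescent-inverse⇐ true (_ ∷ []) ()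
  noInverseDescent-inverse⇐ true (_ ∷ _ ∷ _) _ = tt

  record Decomposition (x y : Bool) (n : ℕ) (w : List ℕ) : Set where
    constructor mkDecomposition
    field
      left right : List ℕ
      is-node : w ≡ node left right
      size : length left + suc (length right) ≡ n
      left-class : Class true y (length left) left
      right-class : Class x (tailFlag left y) (length right) right
      no-tail-descent : NoTailDescent x left right
      no-inverse-descent : NoInverseDescent y left

  -- a nonempty permutation of a class is split at its 0: the prefix lies above the
  -- suffix (213-avoidance), and the node lemmas give the classes of the blocks
  decompose : ∀ {x y n w} → Class x y n w → 0 < n → Decomposition x y n w
  decompose {x} {y} {n} {w} c 0<n with ∈-∃++ (pcover (class-perm c) 0<n)
  ... | u , v , refl = mkDecomposition α β eq (s-n sp) cA cB (proj₂ (proj₂ fwn)) (noInverseDescent-inverse⇒ y α (proj₂ (proj₂ ivn)))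
    where
    sp = perm-split u v (class-perm c) (av-above u v (class-avoids c) (pdist (class-perm c)))
    α = sα sp
    β = sβ sp
    pα = s-pα sp
    pβ = s-pβ sp
    eq : u ++ 0 ∷ v ≡ node α β
    eq = s-eq sp
    fwn = node-simsun⇒ x α β pβ (subst (Simsun⁺ x) eq (class-simsun c))
    Bi = inverseLine (length β) β
    L = inverseLine (length α) α
    inveq : inverseLine n (u ++ 0 ∷ v) ≡ length α ∷ map (suc (length α) +_) Bi ++ L
    inveq = trans (cong₂ inverseLine (sym (s-n sp)) eq) (inv-node pα pβ)
    ivn = InverseNode.inverse-simsun⇒ (length α) Bi L (inv-bound pα) y (inverse-starts-with-ascent pα (proj₁ fwn)) (subst (Simsun⁺ y) inveq (class-inverse c))
    avs = av-parts α β (subst Avoids213 eq (class-avoids c))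
    cA : Class true y (length α) α
    cA = mkClass pα (proj₁ avs) (proj₁ fwn) (proj₁ ivn)
    cB : Class x (tailFlag α y) (length β) β
    cB = mkClass pβ (proj₂ avs) (proj₁ (proj₂ fwn)) (subst (λ t → Simsun⁺ t Bi) (tailFlag-inverse α y) (proj₁ (proj₂ ivn)))

  compose : ∀ {x y α β} → Class true y (length α) α → Class x (tailFlag α y) (length β) β → NoTailDescent x α β → NoInverseDescent y α →
    Class x y (length α + suc (length β)) (node α β)
  compose {x} {y} {α} {β} cA cB nb ns =
    mkClass (perm-node pα pβ) (av-node pβ (class-avoids cA) (class-avoids cB)) (node-simsun⇐ x α β pβ (class-simsun cA) (class-simsun cB) nb)
      (subst (Simsun⁺ y) (sym (inv-node pα pβ))
        (InverseNode.inverse-simsun⇐ (length α) Bi L (inv-bound pα) y (inverse-starts-with-ascent pα (class-simsun cA)) (class-inverse cA)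
          (subst (λ t → Simsun⁺ t Bi) (sym (tailFlag-inverse α y)) (class-inverse cB)) (noInverseDescent-inverse⇐ y α ns)))
    where
    pα = class-perm cA
    pβ = class-perm cB
    Bi = inverseLine (length β) β
    L = inverseLine (length α) α

-- Trees of the first-return decomposition and their encoding by permutations.
module Encoding where

  open Permutations
  open SimsunWords using (simsun-short)
  open Classes
  open import Data.Bool using (Bool; true; false)
  open import Data.Nat using (ℕ; suc; _+_; _≤_; _<_; z≤n; s≤s; _≤?_)
  open import Data.Nat.Properties using (m<m+n; m≤n+m; ≰⇒>; +-cancelˡ-≡; +-suc)
  open import Data.Nat.Tactic.RingSolver using (solve-∀)
  open import Induction.WellFounded using (Acc; acc)
  open import Data.List using (List; []; _∷_; length)
  open import Data.Product using (Σ; _,_; proj₁; proj₂)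
  open import Data.Empty using (⊥-elim)
  open import Data.Unit using (tt)
  open import Relation.Nullary using (yes; no)
  open import Relation.Binary.PropositionalEquality using (_≡_; _≢_; refl; sym; trans; cong; cong₂; subst)

  -- First-return decomposition of Motzkin paths without two consecutive up
  -- steps:  P → ε | L P | U D P | U L P' D P.
  data MTree : Set where
    end : MTree
    level : MTree → MTree
    peak : MTree → MTree
    arch : MTree → MTree → MTree

  size : MTree → ℕ
  size end = 0
  size (level s) = suc (size s)
  size (peak s) = suc (suc (size s))
  size (arch k s) = suc (suc (suc (size k + size s)))

  -- the flags as numbers: a word of class (x , y) encodes a tree only if it has
  -- at least  bit x + bit y  letters
  bit : Bool → ℕ
  bit false = 0
  bit true = 1

  Class′ : Bool → Bool → List ℕ → Set
  Class′ x y w = Class x y (length w) w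

  baseWord : Bool → Bool → List ℕ
  baseWord false false = []
  baseWord false true = 0 ∷ []
  baseWord true false = 0 ∷ []
  baseWord true true = 0 ∷ 1 ∷ []

  -- the word after the minimum in a peak: empty, or one letter when a new minimum is appended
  unitIf : Bool → List ℕ
  unitIf false = []
  unitIf true = 0 ∷ []

  encode : Bool → Bool → MTree → List ℕ
  encode x y (level s) = node [] (encode x y s)
  encode x y (peak s) = node (encode true y s) (unitIf x)
  encode x y (arch k s) = node (encode true y s) (encode x true k)
  encode x y end = baseWord x y

  length-encode : ∀ x y s → length (encode x y s) ≡ bit x + bit y + size s
  length-encode false false end = refl
  length-encode false true end = refl
  length-encode true false end = refl
  length-encode true true end = refl
  length-encode x y (level s) =
    trans (length-node [] (encode x y s)) (trans (cong suc (length-encode x y s)) (sym (+-suc (bit x + bit y) (size s))))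
  length-encode x y (peak s) =
    trans (length-node (encode true y s) (unitIf x))
      (trans (cong₂ (λ a b → a + suc b) (length-encode true y s) (length-unitIf x)) (arith (bit x) (bit y) (size s)))
    where
    length-unitIf : ∀ x → length (unitIf x) ≡ bit x
    length-unitIf false = refl
    length-unitIf true = refl
    arith : ∀ a b c → suc (b + c) + suc a ≡ a + b + suc (suc c)
    arith = solve-∀
  length-encode x y (arch k s) =
    trans (length-node (encode true y s) (encode x true k))
      (trans (cong₂ (λ a b → a + suc b) (length-encode true y s) (length-encode x true k))
        (arith (bit x) (bit y) (size k) (size s)))
    where
    arith : ∀ a b c d → suc (b + d) + suc (a + 1 + c) ≡ a + b + suc (suc (suc (c + d)))
    arith = solve-∀

  class-[] : ∀ x y → Class′ x y []
  class-[] x y = mkClass (mkPerm tt (λ ()) (λ ())) (λ { (_ , _ , _ , () , _) }) (simsun⁺-[] x) (simsun⁺-[] y)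
    where
    simsun⁺-[] : ∀ x → Simsun⁺ x []
    simsun⁺-[] false = simsun-short [] z≤n
    simsun⁺-[] true = simsun-short (0 ∷ []) (s≤s z≤n)

  compose′ : ∀ {x y α β} → Class′ true y α → Class′ x (tailFlag α y) β → NoTailDescent x α β → NoInverseDescent y α → Class′ x y (node α β)
  compose′ {x} {y} {α} {β} cA cB nb ns = subst (λ n → Class x y n (node α β)) (sym (length-node α β)) (compose cA cB nb ns)

  nonempty : ∀ {w : List ℕ} {n} → length w ≡ suc n → w ≢ []
  nonempty e refl with e
  ... | ()

  tailFlag-nonempty : ∀ α y → α ≢ [] → tailFlag α y ≡ true
  tailFlag-nonempty [] y ne = ⊥-elim (ne refl)
  tailFlag-nonempty (_ ∷ _) y ne = refl

  noTailDescent-[] : ∀ x β → NoTailDescent x [] β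
  noTailDescent-[] false β = tt
  noTailDescent-[] true β = tt

  noTailDescent-nonempty : ∀ x α β → β ≢ [] → NoTailDescent x α β
  noTailDescent-nonempty false α β ne = tt
  noTailDescent-nonempty true [] β ne = tt
  noTailDescent-nonempty true (_ ∷ _) [] ne = ⊥-elim (ne refl)
  noTailDescent-nonempty true (_ ∷ _) (_ ∷ _) ne = tt

  noInverseDescent-[] : ∀ y → NoInverseDescent y []
  noInverseDescent-[] false = tt
  noInverseDescent-[] true = tt

  noInverseDescent-long : ∀ y α → 2 ≤ length α → NoInverseDescent y α
  noInverseDescent-long false α _ = tt
  noInverseDescent-long true (_ ∷ []) (s≤s ())
  noInverseDescent-long true (_ ∷ _ ∷ _) _ = tt

  encode-true-nonempty : ∀ y s → encode true y s ≢ []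
  encode-true-nonempty y s = nonempty (length-encode true y s)

  encode-arch-nonempty : ∀ x k → encode x true k ≢ []
  encode-arch-nonempty false k = nonempty (length-encode false true k)
  encode-arch-nonempty true k = nonempty (length-encode true true k)

  unitIf-class : ∀ x → Class′ x true (unitIf x)
  unitIf-class false = class-[] false true
  unitIf-class true = compose′ {α = []} {β = []} (class-[] true true) (class-[] true true) tt tt

  noInverseDescent-encode : ∀ y s → NoInverseDescent y (encode true y s)
  noInverseDescent-encode false s = tt
  noInverseDescent-encode true s = noInverseDescent-long true _ (subst (2 ≤_) (sym (length-encode true true s)) (s≤s (s≤s z≤n)))

  encode-class : ∀ x y s → Class′ x y (encode x y s)
  encode-class x y (level s) = compose′ (class-[] true y) (encode-class x y s) (noTailDescent-[] x _) (noInverseDescent-[] y)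
  encode-class x y (peak s) =
    compose′ (encode-class true y s) (subst (λ t → Class′ x t (unitIf x)) (sym (tailFlag-nonempty _ y (encode-true-nonempty y s))) (unitIf-class x))
      (noTailDescent-unit x) (noInverseDescent-encode y s)
    where
    noTailDescent-unit : ∀ x → NoTailDescent x (encode true y s) (unitIf x)
    noTailDescent-unit false = tt
    noTailDescent-unit true = noTailDescent-nonempty true _ (0 ∷ []) (λ ())
  encode-class x y (arch k s) =
    compose′ (encode-class true y s) (subst (λ t → Class′ x t (encode x true k)) (sym (tailFlag-nonempty _ y (encode-true-nonempty y s))) (encode-class x true k))
      (noTailDescent-nonempty x _ _ (encode-arch-nonempty x k)) (noInverseDescent-encode y s)
  encode-class false false end = class-[] false false
  encode-class false true end = compose′ {α = []} {β = []} (class-[] true true) (class-[] false true) tt tt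
  encode-class true false end = compose′ {α = []} {β = []} (class-[] true false) (class-[] true false) tt tt
  encode-class true true end = compose′ {α = []} {β = 0 ∷ []} (class-[] true true) (unitIf-class true) tt tt

  -- Trees are determined by their encodings: the encoding of a tree is a node
  -- whose two blocks determine the subtrees, and different constructors give
  -- blocks of different lengths.
  size-encode : ∀ x y {s s'} → encode x y s ≡ encode x y s' → size s ≡ size s'
  size-encode x y {s} {s'} e =
    +-cancelˡ-≡ (bit x + bit y) _ _ (trans (sym (length-encode x y s)) (trans (cong length e) (length-encode x y s')))

  size-0 : ∀ {s} → 0 ≡ size s → end ≡ s
  size-0 {end} _ = refl

  unitIf-encode : ∀ x k → unitIf x ≢ encode x true k
  unitIf-encode x k e with trans (cong length e) (length-encode x true k)
  unitIf-encode false k e | ()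
  unitIf-encode true k e | ()

  encode-injective : ∀ x y {s s'} → encode x y s ≡ encode x y s' → s ≡ s'
  encode-injective x y {end} e = size-0 (size-encode x y e)
  encode-injective x y {s} {end} e = sym (size-0 (sym (size-encode x y e)))
  encode-injective x y {level s} {level s'} e =
    cong level (encode-injective x y (proj₂ (node-injective [] _ [] _ e)))
  encode-injective x y {peak s} {peak s'} e =
    cong peak (encode-injective true y (proj₁ (node-injective _ (unitIf x) _ (unitIf x) e)))
  encode-injective x y {arch k s} {arch k' s'} e with node-injective (encode true y s) (encode x true k) (encode true y s') (encode x true k') e
  ... | eα , eβ = cong₂ arch (encode-injective x true eβ) (encode-injective true y eα)
  encode-injective x y {level s} {peak s'} e =
    ⊥-elim (encode-true-nonempty y s' (sym (proj₁ (node-injective [] _ (encode true y s') (unitIf x) e))))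
  encode-injective x y {level s} {arch k' s'} e =
    ⊥-elim (encode-true-nonempty y s' (sym (proj₁ (node-injective [] _ (encode true y s') (encode x true k') e))))
  encode-injective x y {peak s} {level s'} e =
    ⊥-elim (encode-true-nonempty y s (proj₁ (node-injective (encode true y s) (unitIf x) [] _ e)))
  encode-injective x y {arch k s} {level s'} e =
    ⊥-elim (encode-true-nonempty y s (proj₁ (node-injective (encode true y s) (encode x true k) [] _ e)))
  encode-injective x y {peak s} {arch k' s'} e =
    ⊥-elim (unitIf-encode x k' (proj₂ (node-injective (encode true y s) _ (encode true y s') (encode x true k') e)))
  encode-injective x y {arch k s} {peak s'} e =
    ⊥-elim (unitIf-encode x k (sym (proj₂ (node-injective (encode true y s) (encode x true k) (encode true y s') _ e))))

  base-level : ∀ x y β → length β < bit x + bit y → bit x + bit y ≤ suc (length β) → Class′ x y β → baseWord x y ≡ node [] β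
  base-level false true [] _ _ _ = refl
  base-level true false [] _ _ _ = refl
  base-level true true (b ∷ []) _ _ c with perm-one (class-perm c)
  ... | refl = refl
  base-level false false β () _ _
  base-level false true (_ ∷ _) (s≤s ()) _ _
  base-level true false (_ ∷ _) (s≤s ()) _ _
  base-level true true [] _ (s≤s ()) _
  base-level true true (_ ∷ _ ∷ _) (s≤s (s≤s ())) _ _

  unit-right : ∀ x α β → α ≢ [] → length β < bit x + 1 → NoTailDescent x α β → Class′ x true β → unitIf x ≡ β
  unit-right false α [] _ _ _ _ = refl
  unit-right false α (_ ∷ _) _ (s≤s ()) _ _
  unit-right true [] β ne _ _ _ = ⊥-elim (ne refl)
  unit-right true (_ ∷ _) [] _ _ () _
  unit-right true (_ ∷ _) (b ∷ []) _ _ _ c with perm-one (class-perm c)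
  ... | refl = refl
  unit-right true (_ ∷ _) (_ ∷ _ ∷ _) _ (s≤s (s≤s ())) _ _

  long-left : ∀ y α → α ≢ [] → NoInverseDescent y α → bit true + bit y ≤ length α
  long-left y [] ne _ = ⊥-elim (ne refl)
  long-left false (_ ∷ _) _ _ = s≤s z≤n
  long-left true (_ ∷ []) _ ()
  long-left true (_ ∷ _ ∷ _) _ _ = s≤s (s≤s z≤n)

  -- By well-founded induction on the length: split the word at its
  -- minimum into node α β ('decompose') and decode the two blocks.
  decode : ∀ x y w → Acc _<_ (length w) → bit x + bit y ≤ length w → Class′ x y w → Σ MTree λ s → encode x y s ≡ w
  decodeNode : ∀ x y α β → Acc _<_ (length α) → Acc _<_ (length β) → bit x + bit y ≤ suc (length α + length β) →
    Class′ true y α → Class′ x (tailFlag α y) β → NoTailDescent x α β → NoInverseDescent y α → Σ MTree λ s → encode x y s ≡ node α β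

  decode false false [] _ _ _ = end , refl
  decode false true [] _ () _
  decode true y [] _ () _
  decode x y w@(_ ∷ _) (acc rec) long c with decompose c (s≤s z≤n)
  ... | mkDecomposition α β w≡ sz cA cB nb ns =
    subst (λ v → Σ MTree λ s → encode x y s ≡ v) (sym w≡)
      (decodeNode x y α β (rec (left-shorter sz)) (rec (right-shorter sz))
        (subst (bit x + bit y ≤_) (trans (sym sz) (+-suc _ _)) long) cA cB nb ns)
    where
    left-shorter : ∀ {a b n} → a + suc b ≡ n → a < n
    left-shorter {a} refl = m<m+n a (s≤s z≤n)
    right-shorter : ∀ {a b n} → a + suc b ≡ n → b < n
    right-shorter {a} {b} refl = m≤n+m (suc b) a

  decodeNode x y [] β _ accβ long cA cB nb ns with bit x + bit y ≤? length β
  ... | yes le = let (s , e) = decode x y β accβ le cB in level s , cong (node []) e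
  ... | no gt = end , base-level x y β (≰⇒> gt) long cB
  decodeNode x y α@(_ ∷ _) β accα accβ long cA cB nb ns with decode true y α accα (long-left y α (λ ()) ns) cA | bit x + 1 ≤? length β
  ... | s , eα | yes le = let (k , eβ) = decode x true β accβ le cB in arch k s , cong₂ node eα eβ
  ... | s , eα | no gt = peak s , cong₂ node eα (unit-right x α β (λ ()) (≰⇒> gt) nb cB)

-- Trees versus UU-free Motzkin paths.
module MotzkinPaths where

  open import Defs using (Step; U; D; L; motzkinFrom; noUU)
  open Encoding using (MTree; end; level; peak; arch; size)
  open import Data.Bool using (true; _∧_)
  open import Data.Bool.Properties using (∧-conicalˡ; ∧-conicalʳ)
  open import Data.Nat using (ℕ; zero; suc; pred; _+_; _<_; s≤s)
  open import Data.Nat.Properties using (+-suc; m≤m+n; m≤n+m; n<1+n; n≤1+n; <-trans; ≤-trans)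
  open import Induction.WellFounded using (Acc; acc)
  open import Data.List using (List; []; _∷_; _++_; length)
  open import Data.List.Properties using (length-++; ∷-injective; ∷-injectiveʳ)
  open import Data.Product using (Σ; _×_; _,_)
  open import Data.Empty using (⊥; ⊥-elim)
  open import Relation.Binary.PropositionalEquality using (_≡_; refl; sym; trans; cong; cong₂)

  render : MTree → List Step
  render end = []
  render (level s) = L ∷ render s
  render (peak s) = U ∷ D ∷ render s
  render (arch k s) = U ∷ L ∷ render k ++ D ∷ render s

  length-render : ∀ s → length (render s) ≡ size s
  length-render end = refl
  length-render (level s) = cong suc (length-render s)
  length-render (peak s) = cong (λ t → suc (suc t)) (length-render s)
  length-render (arch k s) =
    cong (λ t → suc (suc t))
      (trans (length-++ (render k)) (trans (cong₂ (λ a b → a + suc b) (length-render k) (length-render s)) (+-suc (size k) (size s))))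

  -- 'motzkinFrom h p': p runs from height h down to the axis without crossing it.
  -- The first two equations hold for every height but need a case split on it.
  motzkinFrom-U : ∀ h p → motzkinFrom h (U ∷ p) ≡ motzkinFrom (suc h) p
  motzkinFrom-U zero p = refl
  motzkinFrom-U (suc h) p = refl

  motzkinFrom-L : ∀ h p → motzkinFrom h (L ∷ p) ≡ motzkinFrom h p
  motzkinFrom-L zero p = refl
  motzkinFrom-L (suc h) p = refl

  motzkinFrom-++ : ∀ j h q rest → motzkinFrom j q ≡ true → motzkinFrom (j + h) (q ++ rest) ≡ motzkinFrom h rest
  motzkinFrom-++ zero h [] rest _ = refl
  motzkinFrom-++ j h (U ∷ q) rest m =
    trans (motzkinFrom-U (j + h) (q ++ rest)) (motzkinFrom-++ (suc j) h q rest (trans (sym (motzkinFrom-U j q)) m))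
  motzkinFrom-++ j h (L ∷ q) rest m =
    trans (motzkinFrom-L (j + h) (q ++ rest)) (motzkinFrom-++ j h q rest (trans (sym (motzkinFrom-L j q)) m))
  motzkinFrom-++ (suc j) h (D ∷ q) rest m = motzkinFrom-++ j h q rest m
  motzkinFrom-++ (suc j) h [] rest ()
  motzkinFrom-++ zero h (D ∷ q) rest ()

  noUU-D : ∀ q rest → noUU (q ++ D ∷ rest) ≡ noUU q ∧ noUU rest
  noUU-D [] rest = refl
  noUU-D (U ∷ []) rest = refl
  noUU-D (U ∷ U ∷ q) rest = refl
  noUU-D (U ∷ L ∷ q) rest = noUU-D (L ∷ q) rest
  noUU-D (U ∷ D ∷ q) rest = noUU-D (D ∷ q) rest
  noUU-D (L ∷ q) rest = noUU-D q rest
  noUU-D (D ∷ q) rest = noUU-D q rest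

  render-motzkin : ∀ s → motzkinFrom 0 (render s) ≡ true
  render-motzkin end = refl
  render-motzkin (level s) = render-motzkin s
  render-motzkin (peak s) = render-motzkin s
  render-motzkin (arch k s) = trans (motzkinFrom-++ 0 1 (render k) (D ∷ render s) (render-motzkin k)) (render-motzkin s)

  render-noUU : ∀ s → noUU (render s) ≡ true
  render-noUU end = refl
  render-noUU (level s) = render-noUU s
  render-noUU (peak s) = render-noUU s
  render-noUU (arch k s) = trans (noUU-D (render k) (render s)) (cong₂ _∧_ (render-noUU k) (render-noUU s))

  first-return : ∀ j h p → motzkinFrom (j + suc h) p ≡ true →
    Σ (List Step) λ q → Σ (List Step) λ r' → p ≡ q ++ D ∷ r' × motzkinFrom j q ≡ true × motzkinFrom h r' ≡ true
  first-return j h [] m with trans (cong (λ t → motzkinFrom t []) (sym (+-suc j h))) m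
  ... | ()
  first-return j h (U ∷ p) m with first-return (suc j) h p (trans (sym (motzkinFrom-U (j + suc h) p)) m)
  ... | q , r' , refl , mq , mr = U ∷ q , r' , refl , trans (motzkinFrom-U j q) mq , mr
  first-return j h (L ∷ p) m with first-return j h p (trans (sym (motzkinFrom-L (j + suc h) p)) m)
  ... | q , r' , refl , mq , mr = L ∷ q , r' , refl , trans (motzkinFrom-L j q) mq , mr
  first-return zero h (D ∷ p) m = [] , p , refl , refl , m
  first-return (suc j) h (D ∷ p) m with first-return j h p m
  ... | q , r' , refl , mq , mr = D ∷ q , r' , refl , mq , mr

  after : Step → ℕ → ℕ
  after U h = suc h
  after L h = h
  after D h = pred h

  motzkinFrom-step : ∀ s h q → motzkinFrom h (s ∷ q) ≡ true → motzkinFrom (after s h) q ≡ true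
  motzkinFrom-step U h q m = trans (sym (motzkinFrom-U h q)) m
  motzkinFrom-step L h q m = trans (sym (motzkinFrom-L h q)) m
  motzkinFrom-step D (suc h) q m = m

  no-D-at-axis : ∀ h {q} → motzkinFrom h [] ≡ true → motzkinFrom h (D ∷ q) ≡ true → ⊥
  no-D-at-axis zero _ ()
  no-D-at-axis (suc h) ()

  first-return-unique : ∀ h q q' x x' → motzkinFrom h q ≡ true → motzkinFrom h q' ≡ true →
    q ++ D ∷ x ≡ q' ++ D ∷ x' → q ≡ q' × x ≡ x'
  first-return-unique h [] [] x x' _ _ e = refl , ∷-injectiveʳ e
  first-return-unique h [] (s ∷ q') x x' m m' e with ∷-injective e
  ... | refl , _ = ⊥-elim (no-D-at-axis h m m')
  first-return-unique h (s ∷ q) [] x x' m m' e with ∷-injective e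
  ... | refl , _ = ⊥-elim (no-D-at-axis h m' m)
  first-return-unique h (s ∷ q) (s' ∷ q') x x' m m' e with ∷-injective e
  ... | refl , e' with first-return-unique (after s h) q q' x x' (motzkinFrom-step s h q m) (motzkinFrom-step s h q' m') e'
  ... | refl , refl = refl , refl

  render-injective : ∀ {s s'} → render s ≡ render s' → s ≡ s'
  render-injective {end} {end} _ = refl
  render-injective {level s} {level s'} e = cong level (render-injective (∷-injectiveʳ e))
  render-injective {peak s} {peak s'} e = cong peak (render-injective (∷-injectiveʳ (∷-injectiveʳ e)))
  render-injective {arch k s} {arch k' s'} e
    with first-return-unique 0 (render k) (render k') (render s) (render s') (render-motzkin k) (render-motzkin k')
           (∷-injectiveʳ (∷-injectiveʳ e))
  ... | ek , es = cong₂ arch (render-injective ek) (render-injective es)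
  render-injective {end} {level _} ()
  render-injective {end} {peak _} ()
  render-injective {end} {arch _ _} ()
  render-injective {level _} {end} ()
  render-injective {level _} {peak _} ()
  render-injective {level _} {arch _ _} ()
  render-injective {peak _} {end} ()
  render-injective {peak _} {level _} ()
  render-injective {peak _} {arch _ _} ()
  render-injective {arch _ _} {end} ()
  render-injective {arch _ _} {level _} ()
  render-injective {arch _ _} {peak _} ()

  parse : ∀ p → Acc _<_ (length p) → motzkinFrom 0 p ≡ true → noUU p ≡ true → Σ MTree λ s → render s ≡ p
  parse [] _ _ _ = end , refl
  parse (L ∷ p) (acc rec) m u with parse p (rec (n<1+n _)) m u
  ... | s , e = level s , cong (L ∷_) e
  parse (U ∷ p) (acc rec) m u with first-return 0 0 p m
  ... | [] , r' , refl , _ , mr with parse r' (rec (<-trans (n<1+n _) (n<1+n _))) mr u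
  ...   | s , e = peak s , cong (λ t → U ∷ D ∷ t) e
  parse (U ∷ p) (acc rec) m u | L ∷ q , r' , refl , mq , mr =
    let u' = trans (sym (noUU-D q r')) u
        (k , ek) = parse q (rec (shorterˡ q r')) mq (∧-conicalˡ (noUU q) (noUU r') u')
        (s , es) = parse r' (rec (shorterʳ q r')) mr (∧-conicalʳ (noUU q) (noUU r') u')
    in arch k s , cong (λ t → U ∷ L ∷ t) (cong₂ (λ a b → a ++ D ∷ b) ek es)
    where
    shorterˡ : ∀ q r' → length q < length (U ∷ L ∷ q ++ D ∷ r')
    shorterˡ q r' rewrite length-++ q {D ∷ r'} = s≤s (≤-trans (m≤m+n (length q) (suc (length r'))) (n≤1+n _))
    shorterʳ : ∀ q r' → length r' < length (U ∷ L ∷ q ++ D ∷ r')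
    shorterʳ q r' rewrite length-++ q {D ∷ r'} = s≤s (≤-trans (n≤1+n _) (≤-trans (m≤n+m (suc (length r')) (length q)) (n≤1+n _)))
  parse (U ∷ p) (acc rec) m () | U ∷ q , r' , refl , mq , mr
  parse (U ∷ p) (acc rec) m u | D ∷ q , r' , refl , () , mr
  parse (D ∷ p) _ () _

module Bijections where

  open import Defs
  open Permutations
  open import Data.List.Properties using (length-map; map-injective; ∷-injectiveˡ; ∷-injectiveʳ)
  open SimsunWords using (Simsun; hDD; restrict-none; restrict-all; <ᵇ-true; <ᵇ-false)
  open Avoidance using (Has213; sub→ss; ss→sub)
  open Inverses using (inv-bound)
  open Classes using (Class; mkClass; class-perm; class-avoids; class-simsun; class-inverse)
  open Encoding
  open MotzkinPaths
  open import Data.Bool using (Bool; true; false; T; _∧_; not)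
  open import Data.Bool.Properties using (T-∧; T-≡; T-not-≡; T-irrelevant)
  open import Data.Bool.ListAction using (all)
  open import Data.Nat using (ℕ; zero; suc; _≤_; _<_; z≤n; _≤?_; _<ᵇ_; _≡ᵇ_)
  open import Data.Nat.Properties using (suc-injective; ≤-refl; <-trans; ≰⇒>; <⇒≤; ≡ᵇ⇒≡; ≡⇒≡ᵇ; <ᵇ⇒<; ≡-irrelevant)
  open import Data.Nat.Induction using (<-wellFounded)
  open import Data.Fin using (Fin; toℕ; fromℕ<)
  open import Data.Fin.Properties using (toℕ<n; toℕ-fromℕ<; toℕ-injective)
  open import Data.List using (List; []; _∷_; map; length; upTo)
  open import Data.List.Membership.Propositional using (_∈_; find; lose)
  open import Data.List.Membership.Propositional.Properties using (∈-map⁻; ∈-upTo⁺)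
  open import Data.List.Relation.Unary.Any using (here; there)
  import Data.List.Relation.Unary.All as All
  open import Data.List.Relation.Unary.All.Properties using (all⁺; all⁻)
  open import Data.List.Relation.Unary.Any.Properties using (any⁺; any⁻)
  open import Data.Vec using (Vec; toList)
  import Data.Vec as Vec
  open import Data.Vec.Properties using (length-toList; toList-map)
  open import Data.Product using (Σ; _×_; _,_; proj₁; proj₂)
  open import Data.Unit using (tt)
  open import Relation.Nullary using (¬_; yes; no)
  open import Relation.Binary.PropositionalEquality using (_≡_; refl; sym; trans; cong; cong₂; subst)
  open import Function using (_∘_)
  open import Function.Bundles using (_↔_; mk↔ₛ′; Equivalence)

  open Equivalence using (to; from)

  T-not : ∀ {b} → ¬ T b → T (not b)
  T-not {true} f = f tt
  T-not {false} _ = tt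

  T-not⁻ : ∀ {b} → T (not b) → ¬ T b
  T-not⁻ {true} ()

  all-∈⁺ : ∀ {A : Set} (p : A → Bool) xs → (∀ {x} → x ∈ xs → T (p x)) → T (all p xs)
  all-∈⁺ p xs h = all⁻ p (All.tabulate h)

  all-∈⁻ : ∀ {A : Set} (p : A → Bool) xs → T (all p xs) → ∀ {x} → x ∈ xs → T (p x)
  all-∈⁻ p xs t = All.lookup (all⁺ p xs t)

  distinct⇒Dist : ∀ w → T (distinct w) → Dist w
  distinct⇒Dist [] _ = tt
  distinct⇒Dist (x ∷ w) t =
    let (fresh , rest) = to T-∧ t
    in (λ x∈w → T-not⁻ (all-∈⁻ _ w fresh x∈w) (≡⇒≡ᵇ x x refl)) , distinct⇒Dist w rest

  Dist⇒distinct : ∀ w → Dist w → T (distinct w)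
  Dist⇒distinct [] _ = tt
  Dist⇒distinct (x ∷ w) (x∉w , d) =
    from T-∧ (all-∈⁺ _ w (λ {y} y∈w → T-not (λ x≡y → x∉w (subst (_∈ w) (sym (≡ᵇ⇒≡ x y x≡y)) y∈w))) , Dist⇒distinct w d)

  Simsun⇒simsun : ∀ n w → Simsun w → T (simsun n w)
  Simsun⇒simsun n w s = all-∈⁺ _ (upTo n) (λ {k} _ → from T-not-≡ (s (suc k)))

  -- Defs only tests the restrictions to {1..k} for k ≤ n; for larger k the
  -- restriction of a word with letters below n is the whole word.
  simsun⇒restrictions : ∀ n w → T (simsun n w) → ∀ k → k ≤ n → hDD (restrict k w) ≡ false
  simsun⇒restrictions n w t zero _ = cong hDD (restrict-none 0 w (λ _ → z≤n))
  simsun⇒restrictions n w t (suc k) k<n = to T-not-≡ (all-∈⁻ _ (upTo n) t (∈-upTo⁺ k<n))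

  simsun⇒Simsun : ∀ n w → (∀ {x} → x ∈ w → x < n) → T (simsun n w) → Simsun w
  simsun⇒Simsun n w below t k with k ≤? n
  ... | yes k≤n = simsun⇒restrictions n w t k k≤n
  ... | no k≰n =
    trans (cong hDD (trans (restrict-all k w (λ x∈w → <-trans (below x∈w) (≰⇒> k≰n))) (sym (restrict-all n w below))))
      (simsun⇒restrictions n w t n ≤-refl)

  is213 : List ℕ → Bool
  is213 s = (length s ≡ᵇ length p213) ∧ sameOrder s p213

  is213-complete : ∀ {a b c} → b < a → a < c → T (is213 (a ∷ b ∷ c ∷ []))
  is213-complete {a} {b} {c} b<a a<c
    rewrite <ᵇ-false {a} {b} (<⇒≤ b<a) | <ᵇ-true b<a | <ᵇ-true a<c | <ᵇ-false {c} {a} (<⇒≤ a<c)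
          | <ᵇ-true (<-trans b<a a<c) | <ᵇ-false {c} {b} (<⇒≤ (<-trans b<a a<c)) = tt

  -- the conjuncts are tested in the order  a <ᵇ b , b <ᵇ a , a <ᵇ c , …
  is213-sound : ∀ s → T (is213 s) → Σ ℕ λ a → Σ ℕ λ b → Σ ℕ λ c → s ≡ a ∷ b ∷ c ∷ [] × b < a × a < c
  is213-sound (a ∷ b ∷ c ∷ []) t with a <ᵇ b
  ... | false with b <ᵇ a in b<a
  ...   | true with a <ᵇ c in a<c
  ...     | true = a , b , c , refl , <ᵇ⇒< b a (from T-≡ b<a) , <ᵇ⇒< a c (from T-≡ a<c)

  Has213⇒contains : ∀ w → Has213 w → T (containsPattern p213 w)
  Has213⇒contains w (a , b , c , sub , b<a , a<c) = any⁺ is213 (lose (sub→ss sub) (is213-complete b<a a<c))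

  contains⇒Has213 : ∀ w → T (containsPattern p213 w) → Has213 w
  contains⇒Has213 w t with find (any⁻ is213 (subsequences w) t)
  ... | s , s∈ , ts with is213-sound s ts
  ... | a , b , c , refl , b<a , a<c = a , b , c , ss→sub w s∈ , b<a , a<c

  isDRSWord : ℕ → List ℕ → Bool
  isDRSWord n w = distinct w ∧ not (containsPattern p213 w) ∧ simsun n w ∧ simsun n (inverseLine n w)

  class⇒isDRSWord : ∀ {n w} → Class false false n w → T (isDRSWord n w)
  class⇒isDRSWord {n} {w} c =
    from T-∧ (Dist⇒distinct w (pdist (class-perm c)) ,
    from T-∧ (T-not (class-avoids c ∘ contains⇒Has213 w) ,
    from T-∧ (Simsun⇒simsun n w (class-simsun c) , Simsun⇒simsun n (inverseLine n w) (class-inverse c))))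

  isDRSWord⇒class : ∀ {n} w → length w ≡ n → (∀ {x} → x ∈ w → x < n) → T (isDRSWord n w) → Class false false n w
  isDRSWord⇒class {n} w len below t =
    let (td , t') = to T-∧ t
        (prefix , t'') = to T-∧ t'
        (ts , ti) = to T-∧ t''
        perm = distinct-below⇒Perm w len below (distinct⇒Dist w td)
    in mkClass perm (T-not⁻ prefix ∘ Has213⇒contains w) (simsun⇒Simsun n w below ts) (simsun⇒Simsun n (inverseLine n w) (inv-bound perm) ti)

  module _ {A : Set} where
    vecOf : ∀ {n} (l : List A) → length l ≡ n → Vec A n
    vecOf {zero} [] _ = Vec.[]
    vecOf {suc n} (x ∷ l) e = x Vec.∷ vecOf l (suc-injective e)

    toList-vecOf : ∀ {n} (l : List A) (e : length l ≡ n) → toList (vecOf l e) ≡ l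
    toList-vecOf {zero} [] _ = refl
    toList-vecOf {suc n} (x ∷ l) e = cong (x ∷_) (toList-vecOf l (suc-injective e))

    toList-injective : ∀ {n} (v v' : Vec A n) → toList v ≡ toList v' → v ≡ v'
    toList-injective Vec.[] Vec.[] _ = refl
    toList-injective (x Vec.∷ v) (x' Vec.∷ v') e = cong₂ Vec._∷_ (∷-injectiveˡ e) (toList-injective v v' (∷-injectiveʳ e))

  finList : ∀ {m} (l : List ℕ) → (∀ {x} → x ∈ l → x < m) → List (Fin m)
  finList [] _ = []
  finList (x ∷ l) below = fromℕ< (below (here refl)) ∷ finList l (below ∘ there)

  map-toℕ-finList : ∀ {m} l (below : ∀ {x} → x ∈ l → x < m) → map toℕ (finList l below) ≡ l
  map-toℕ-finList [] _ = refl
  map-toℕ-finList (x ∷ l) below = cong₂ _∷_ (toℕ-fromℕ< (below (here refl))) (map-toℕ-finList l (below ∘ there))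

  fromOneLine : ∀ {n} (l : List ℕ) → length l ≡ n → (∀ {x} → x ∈ l → x < n) → Vec (Fin n) n
  fromOneLine l len below = vecOf (finList l below) (trans (sym (length-map toℕ (finList l below))) (trans (cong length (map-toℕ-finList l below)) len))

  oneLine-fromOneLine : ∀ {n} l (len : length l ≡ n) (below : ∀ {x} → x ∈ l → x < n) → oneLine (fromOneLine l len below) ≡ l
  oneLine-fromOneLine l len below =
    trans (toList-map toℕ (fromOneLine l len below)) (trans (cong (map toℕ) (toList-vecOf (finList l below) _)) (map-toℕ-finList l below))

  oneLine-injective : ∀ {n} (σ τ : Vec (Fin n) n) → oneLine σ ≡ oneLine τ → σ ≡ τ
  oneLine-injective σ τ e =
    toList-injective σ τ (map-injective toℕ-injective (trans (sym (toList-map toℕ σ)) (trans e (toList-map toℕ τ))))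

  length-oneLine : ∀ {n} (σ : Vec (Fin n) n) → length (oneLine σ) ≡ n
  length-oneLine σ = length-toList (Vec.map toℕ σ)

  oneLine-below : ∀ {n} (σ : Vec (Fin n) n) → ∀ {x} → x ∈ oneLine σ → x < n
  oneLine-below σ x∈ with ∈-map⁻ toℕ (subst (_ ∈_) (toList-map toℕ σ) x∈)
  ... | i , _ , refl = toℕ<n i

  Trees : ℕ → Set
  Trees n = Σ MTree λ s → size s ≡ n

  trees-≡ : ∀ {n s s'} {e : size s ≡ n} {e' : size s' ≡ n} → s ≡ s' → _≡_ {A = Trees n} (s , e) (s' , e')
  trees-≡ {s = s} refl = cong (s ,_) (≡-irrelevant _ _)

  module _ {V : Set} {n : ℕ} (Q : V → Set) (Q-irrelevant : ∀ {v} (p q : Q v) → p ≡ q)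
           (enc : Trees n → V) (enc-Q : ∀ t → Q (enc t))
           (enc-injective : ∀ {t t'} → enc t ≡ enc t' → t ≡ t')
           (dec : ∀ v → Q v → Σ (Trees n) λ t → enc t ≡ v) where

    encoding↔ : Σ V Q ↔ Trees n
    encoding↔ = mk↔ₛ′ (λ (v , q) → proj₁ (dec v q)) (λ t → enc t , enc-Q t)
      (λ t → enc-injective (proj₂ (dec (enc t) (enc-Q t))))
      (λ (v , q) → Σ-≡ (proj₂ (dec v q)))
      where
      Σ-≡ : ∀ {v v'} {q : Q v} {q' : Q v'} → v ≡ v' → _≡_ {A = Σ V Q} (v , q) (v' , q')
      Σ-≡ refl = cong (_ ,_) (Q-irrelevant _ _)

  drs↔trees : ∀ n → DRS p213 n ↔ Trees n
  drs↔trees n = encoding↔ (T ∘ isDRS p213) T-irrelevant perm perm-isDRS perm-injective parsePerm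
    where
    word-length : ∀ ((s , e) : Trees n) → length (encode false false s) ≡ n
    word-length (s , e) = trans (length-encode false false s) e
    word-class : ∀ ((s , e) : Trees n) → Class false false n (encode false false s)
    word-class t@(s , _) = subst (λ m → Class false false m _) (word-length t) (encode-class false false s)
    perm : Trees n → Vec (Fin n) n
    perm t@(s , _) = fromOneLine (encode false false s) (word-length t) (pbound (class-perm (word-class t)))
    oneLine-perm : ∀ t → oneLine (perm t) ≡ encode false false (proj₁ t)
    oneLine-perm t@(s , _) = oneLine-fromOneLine (encode false false s) (word-length t) (pbound (class-perm (word-class t)))
    perm-isDRS : ∀ t → T (isDRS p213 (perm t))
    perm-isDRS t = subst (T ∘ isDRSWord n) (sym (oneLine-perm t)) (class⇒isDRSWord (word-class t))
    perm-injective : ∀ {t t'} → perm t ≡ perm t' → t ≡ t'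
    perm-injective {t} {t'} e =
      trees-≡ (encode-injective false false (trans (sym (oneLine-perm t)) (trans (cong oneLine e) (oneLine-perm t'))))
    parsePerm : ∀ σ → T (isDRS p213 σ) → Σ (Trees n) λ t → perm t ≡ σ
    parsePerm σ d with decode false false (oneLine σ) (<-wellFounded _) z≤n
           (subst (λ m → Class false false m (oneLine σ)) (sym (length-oneLine σ))
             (isDRSWord⇒class (oneLine σ) (length-oneLine σ) (oneLine-below σ) d))
    ... | s , e = t , oneLine-injective (perm t) σ (trans (oneLine-perm t) e)
      where
      t : Trees n
      t = s , trans (sym (length-encode false false s)) (trans (cong length e) (length-oneLine σ))

  motzkin↔trees : ∀ n → MotzkinNoUU n ↔ Trees n
  motzkin↔trees n = encoding↔ (λ v → T (isMotzkin (toList v) ∧ noUU (toList v))) T-irrelevant path path-valid path-injective parsePath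
    where
    path : Trees n → Vec Step n
    path (s , e) = vecOf (render s) (trans (length-render s) e)
    toList-path : ∀ t → toList (path t) ≡ render (proj₁ t)
    toList-path (s , e) = toList-vecOf (render s) _
    path-valid : ∀ t → T (isMotzkin (toList (path t)) ∧ noUU (toList (path t)))
    path-valid t@(s , _) rewrite toList-path t = from T-∧ (from T-≡ (render-motzkin s) , from T-≡ (render-noUU s))
    path-injective : ∀ {t t'} → path t ≡ path t' → t ≡ t'
    path-injective {t} {t'} e = trees-≡ (render-injective (trans (sym (toList-path t)) (trans (cong toList e) (toList-path t'))))
    parsePath : ∀ v → T (isMotzkin (toList v) ∧ noUU (toList v)) → Σ (Trees n) λ t → path t ≡ v
    parsePath v valid with to T-∧ valid
    ... | m , u with parse (toList v) (<-wellFounded _) (to T-≡ m) (to T-≡ u)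
    ... | s , e = t , toList-injective (path t) v (trans (toList-path t) e)
      where
      t : Trees n
      t = s , trans (sym (length-render s)) (trans (cong length e) (length-toList v))

open import Defs using (DRS; p213; MotzkinNoUU)
open import Data.Nat using (ℕ; _≤_)
open import Function.Bundles using (_↔_)
open import Function.Properties.Inverse using (↔-trans; ↔-sym)
open Bijections using (drs↔trees; motzkin↔trees)

-- DRS_n(213) ↔ trees with n steps ↔ UU-free Motzkin paths of length n
theorem3p3 : (n : ℕ) → 1 ≤ n → DRS p213 n ↔ MotzkinNoUU n
theorem3p3 n _ = ↔-trans (drs↔trees n) (↔-sym (motzkin↔trees n))
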